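{- Let $r\ge 2$, $k\ge 1$ and $n\ge 2r$ be integers, and let $G_n$ be the graph with vertex set $\{(i,X) : 1\le i\le k,\ X\subseteq[n],\ |X|=r\}$, where $(i,X)$ and $(j,Y)$ are adjacent iff either $i=j$ and $X\cap Y=\emptyset$, or $i\ne j$ and $X\cap Y\ne\emptyset$. Then there exist an independent set $H$ of $G_n$ of maximum size and a partition of $[n]$ into pairwise disjoint (possibly empty) sets $S_1,\dots,S_k$ such that every vertex $(i,X)\in H$ satisfies $X\subseteq S_i$, and at least one of the following holds: (1) exactly one of the $S_i$ is nonempty (so it equals $[n]$); or (2) each $S_i$ has size either $0$ or $2r-1$.
   Context: $[n]=\{1,\dots,n\}$. An independent set is a set of pairwise non-adjacent vertices. -}

module Defs where

open import Data.Nat using (ℕ; _≤_)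
open import Data.Fin using (Fin)
open import Data.Fin.Subset using (Subset; _∩_; ⊥; ∣_∣; _⊆_; _∈_; Nonempty; Empty)
open import Data.Product using (_×_; Σ; ∃; _,_; proj₁; proj₂)
open import Data.Sum using (_⊎_)
open import Data.List using (List; length)
open import Data.List.Membership.Propositional renaming (_∈_ to _∈ₗ_)
open import Data.List.Relation.Unary.Unique.Propositional using (Unique)
open import Relation.Binary.PropositionalEquality using (_≡_)
open import Relation.Nullary using (¬_)

-- A vertex (i , X) of G_n: colour i ∈ Fin k (standing for 1..k), X ⊆ [n] (as Fin n).
-- The size condition |X| = r is imposed separately (IsVertex).
Vertex : ℕ → ℕ → Set
Vertex k n = Fin k × Subset n

IsVertex : ∀ {k n} → ℕ → Vertex k n → Set
IsVertex r (i , X) = ∣ X ∣ ≡ r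

Disj : ∀ {n} → Subset n → Subset n → Set
Disj X Y = X ∩ Y ≡ ⊥

Adj : ∀ {k n} → Vertex k n → Vertex k n → Set
Adj (i , X) (j , Y) = (i ≡ j × Disj X Y) ⊎ (¬ i ≡ j × ¬ Disj X Y)

IsIndependent : ∀ {k n} → ℕ → List (Vertex k n) → Set
IsIndependent r H =
  Unique H
  × (∀ {u} → u ∈ₗ H → IsVertex r u)
  × (∀ {u v} → u ∈ₗ H → v ∈ₗ H → ¬ u ≡ v → ¬ Adj u v)

IsMaxIndependent : ∀ {k n} → ℕ → List (Vertex k n) → Set
IsMaxIndependent {k} {n} r H =
  IsIndependent r H × (∀ (H' : List (Vertex k n)) → IsIndependent r H' → length H' ≤ length H)

IsPartition : ∀ {k n} → (Fin k → Subset n) → Set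
IsPartition {k} {n} S =
  (∀ (i j : Fin k) → ¬ i ≡ j → Disj (S i) (S j))
  × (∀ (x : Fin n) → ∃ λ i → x ∈ S i)

ExactlyOneNonempty : ∀ {k n} → (Fin k → Subset n) → Set
ExactlyOneNonempty {k} S = ∃ λ i → Nonempty (S i) × (∀ (j : Fin k) → ¬ j ≡ i → Empty (S j))

-- Split an independent set H by colour. Two members of one colour must meet, so each colour
-- class is an intersecting r-uniform family; two members of different colours must be
-- disjoint, so the supports W_i of the classes are pairwise disjoint and Σ |W_i| ≤ n. A class
-- on a support of size w has at most g(w) members, where g(w) = C(w-1, r-1) if w ≥ 2r
-- (Erdős–Ko–Rado, proved below by shifting) and g(w) = C(w, r) otherwise. For r ≥ 3 the
-- function g is superadditive, so |H| ≤ g(n) = C(n-1, r-1), which the star of a single colour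
-- attains. For r = 2, g(w) ≤ w with equality only for w ∈ {0, 3}; so |H| = n forces n = 3m
-- with m ≤ k, attained by m disjoint triangles of distinct colours, and otherwise
-- |H| ≤ n - 1 = C(n-1, 1), attained again by the star.

module Submission where

open import Defs
open import Data.Nat using (ℕ; _≤_; _*_; _∸_)
open import Data.Fin using (Fin)
open import Data.Fin.Subset using (Subset; _⊆_; ∣_∣)
open import Data.Product using (_×_; Σ; ∃; _,_; proj₁; proj₂)
open import Data.Sum using (_⊎_; inj₁; inj₂)
open import Data.List using (List)
open import Data.List.Membership.Propositional using (_∈_; _∉_; find; lose)
open import Relation.Binary.PropositionalEquality
  using (_≡_; _≗_; refl; sym; trans; cong; cong₂; subst; subst₂; module ≡-Reasoning)

open import Data.Bool.Base using (Bool; true; false; if_then_else_)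
open import Data.Bool.Properties using () renaming (_≟_ to _≟ᵇ_)
open import Data.Empty using (⊥-elim)
open import Data.Fin.Base using (zero; suc; inject≤)
open import Data.Fin.Properties as Finₚ using (any?) renaming (_≟_ to _≟ᶠ_)
open import Data.Fin.Subset using (_∩_; _∪_; _─_; ⁅_⁆; ⊥; ⊤; ⋃; Nonempty)
  renaming (_∈_ to _∈ₛ_; _∉_ to _∉ₛ_)
open import Data.Fin.Subset.Properties
open import Data.List.Base using ([]; _∷_; length; map; _++_)
open import Data.List.Properties using (length-map; length-++)
open import Data.List.Membership.Propositional.Properties using (∈-map⁻; ∈-++⁻)
open import Data.List.Relation.Unary.All using ([]; _∷_)
open import Data.List.Relation.Unary.All.Properties using (¬Any⇒All¬)
open import Data.List.Relation.Unary.AllPairs using ([]; _∷_)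
open import Data.List.Relation.Unary.Any as Any using (here; there)
open import Data.List.Relation.Unary.Unique.Propositional using (Unique)
open import Data.List.Relation.Unary.Unique.Propositional.Properties using (Unique[x∷xs]⇒x∉xs; ++⁺; map⁺)
open import Data.Nat.Base using (zero; suc; pred; _+_; _<_; z≤n; s≤s; _≤′_; ≤′-refl; ≤′-step)
open import Data.Nat.Combinatorics using (_C_; nCk+nC[k+1]≡[n+1]C[k+1]; nC1≡n)
open import Data.Nat.Divisibility using (_∣?_; divides)
open import Data.Nat.Induction using (<-wellFounded)
open import Data.Nat.Properties
open import Algebra.Properties.CommutativeMonoid.Sum +-0-commutativeMonoid
  using (sum; ∑-distrib-+; sum-cong-≗; sum-replicate-zero)
open import Data.Nat.Tactic.RingSolver using (solve-∀)
open import Data.Vec.Base using ([]; _∷_; here; there; head; tail)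
open import Data.Vec.Properties using (≡-dec; ∷-injectiveʳ)
open import Function.Base using (_∘_; _∘₂_)
open import Induction.WellFounded using (Acc; acc)
open import Relation.Nullary using (¬_; Dec; yes; no; ¬?; does)
open import Relation.Nullary.Decidable using (_×-dec_)

private
  variable
    k n : ℕ
    X : Set

∣p─q∣+∣q∣≡∣p∣ : (p q : Subset n) → q ⊆ p → ∣ p ─ q ∣ + ∣ q ∣ ≡ ∣ p ∣
∣p─q∣+∣q∣≡∣p∣ [] [] _ = refl
∣p─q∣+∣q∣≡∣p∣ (true ∷ p) (true ∷ q) q⊆p = trans (+-suc _ _) (cong suc (∣p─q∣+∣q∣≡∣p∣ p q (drop-∷-⊆ q⊆p)))
∣p─q∣+∣q∣≡∣p∣ (false ∷ p) (true ∷ q) q⊆p with q⊆p here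
... | ()
∣p─q∣+∣q∣≡∣p∣ (true ∷ p) (false ∷ q) q⊆p = cong suc (∣p─q∣+∣q∣≡∣p∣ p q (drop-∷-⊆ q⊆p))
∣p─q∣+∣q∣≡∣p∣ (false ∷ p) (false ∷ q) q⊆p = ∣p─q∣+∣q∣≡∣p∣ p q (drop-∷-⊆ q⊆p)

x∈p─q⇒x∉q : ∀ {x} (p q : Subset n) → x ∈ₛ p ─ q → x ∉ₛ q
x∈p─q⇒x∉q (_ ∷ p) (true ∷ q) (there x∈) (there x∈q) = x∈p─q⇒x∉q p q x∈ x∈q
x∈p─q⇒x∉q (_ ∷ p) (false ∷ q) (there x∈) (there x∈q) = x∈p─q⇒x∉q p q x∈ x∈q

─-injective : ∀ (p : Subset n) {q r} → q ⊆ p → r ⊆ p → p ─ q ≡ p ─ r → q ≡ r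
─-injective p {q} {r} q⊆p r⊆p eq = ⊆-antisym (inj q⊆p r⊆p eq) (inj r⊆p q⊆p (sym eq))
  where
  inj : ∀ {q r} → q ⊆ p → r ⊆ p → p ─ q ≡ p ─ r → q ⊆ r
  inj {q = q} {r = r} q⊆p _ eq {x} x∈q with x ∈? r
  ... | yes x∈r = x∈r
  ... | no x∉r = ⊥-elim (x∈p─q⇒x∉q p q (subst′ (x∈p∧x∉q⇒x∈p─q (q⊆p x∈q) x∉r)) x∈q)
    where subst′ : x ∈ₛ p ─ r → x ∈ₛ p ─ q
          subst′ = subst (x ∈ₛ_) (sym eq)

∣p∪⁅x⁆∣≡1+∣p∣ : ∀ {x} (p : Subset n) → x ∉ₛ p → ∣ p ∪ ⁅ x ⁆ ∣ ≡ suc ∣ p ∣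
∣p∪⁅x⁆∣≡1+∣p∣ {x = zero} (false ∷ p) _ = cong suc (cong ∣_∣ (∪-identityʳ p))
∣p∪⁅x⁆∣≡1+∣p∣ {x = zero} (true ∷ p) x∉p = ⊥-elim (x∉p here)
∣p∪⁅x⁆∣≡1+∣p∣ {x = suc x} (true ∷ p) x∉p = cong suc (∣p∪⁅x⁆∣≡1+∣p∣ p (x∉p ∘ there))
∣p∪⁅x⁆∣≡1+∣p∣ {x = suc x} (false ∷ p) x∉p = ∣p∪⁅x⁆∣≡1+∣p∣ p (x∉p ∘ there)

∪⁅x⁆-injective : ∀ {x} {p q : Subset n} → x ∉ₛ p → x ∉ₛ q → p ∪ ⁅ x ⁆ ≡ q ∪ ⁅ x ⁆ → p ≡ q
∪⁅x⁆-injective x∉p x∉q eq = ⊆-antisym (inj x∉p eq) (inj x∉q (sym eq))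
  where
  inj : ∀ {x} {p q : Subset n} → x ∉ₛ p → p ∪ ⁅ x ⁆ ≡ q ∪ ⁅ x ⁆ → p ⊆ q
  inj {x = x} {p = p} {q = q} x∉p eq {y} y∈p with x∈p∪q⁻ q ⁅ x ⁆ (subst (y ∈ₛ_) eq (x∈p∪q⁺ (inj₁ y∈p)))
  ... | inj₁ y∈q = y∈q
  ... | inj₂ y∈⁅x⁆ = ⊥-elim (x∉p (subst (_∈ₛ p) (x∈⁅y⁆⇒x≡y x y∈⁅x⁆) y∈p))

∣p∣≡1⇒p≡⁅x⁆ : ∀ {x} {p : Subset n} → ∣ p ∣ ≡ 1 → x ∈ₛ p → p ≡ ⁅ x ⁆
∣p∣≡1⇒p≡⁅x⁆ {x = x} {p} ∣p∣≡1 x∈p = ⊆-antisym p⊆⁅x⁆ ⁅x⁆⊆p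
  where
  ⁅x⁆⊆p : ⁅ x ⁆ ⊆ p
  ⁅x⁆⊆p z∈ = subst (_∈ₛ p) (sym (x∈⁅y⁆⇒x≡y x z∈)) x∈p
  p⊆⁅x⁆ : p ⊆ ⁅ x ⁆
  p⊆⁅x⁆ {z} z∈p with z ∈? ⁅ x ⁆
  ... | yes z∈ = z∈
  ... | no z∉ = ⊥-elim (<-irrefl refl (subst₂ _<_ (∣⁅x⁆∣≡1 x) ∣p∣≡1 (p⊂q⇒∣p∣<∣q∣ (⁅x⁆⊆p , z , z∈p , z∉))))

∣p∪q∣≤∣p∣+∣q∣ : (p q : Subset n) → ∣ p ∪ q ∣ ≤ ∣ p ∣ + ∣ q ∣
∣p∪q∣≤∣p∣+∣q∣ [] [] = z≤n
∣p∪q∣≤∣p∣+∣q∣ (true ∷ p) (b ∷ q) = s≤s (≤-trans (∣p∪q∣≤∣p∣+∣q∣ p q) (+-monoʳ-≤ ∣ p ∣ (∣p∣≤∣x∷p∣ b q)))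
∣p∪q∣≤∣p∣+∣q∣ (false ∷ p) (true ∷ q) =
  ≤-trans (s≤s (∣p∪q∣≤∣p∣+∣q∣ p q)) (≤-reflexive (sym (+-suc ∣ p ∣ ∣ q ∣)))
∣p∪q∣≤∣p∣+∣q∣ (false ∷ p) (false ∷ q) = ∣p∪q∣≤∣p∣+∣q∣ p q

there-∖ : ∀ {s t} {p q : Subset n} → (∃ λ x → x ∈ₛ p × x ∉ₛ q) → ∃ λ x → x ∈ₛ s ∷ p × x ∉ₛ t ∷ q
there-∖ (x , x∈p , x∉q) = suc x , there x∈p , x∉q ∘ drop-there

∣q∣<∣p∣⇒∃x∈p∖q : (p q : Subset n) → ∣ q ∣ < ∣ p ∣ → ∃ λ x → x ∈ₛ p × x ∉ₛ q
∣q∣<∣p∣⇒∃x∈p∖q (true ∷ p) (false ∷ q) _ = zero , here , λ ()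
∣q∣<∣p∣⇒∃x∈p∖q (true ∷ p) (true ∷ q) (s≤s lt) = there-∖ (∣q∣<∣p∣⇒∃x∈p∖q p q lt)
∣q∣<∣p∣⇒∃x∈p∖q (false ∷ p) (false ∷ q) lt = there-∖ (∣q∣<∣p∣⇒∃x∈p∖q p q lt)
∣q∣<∣p∣⇒∃x∈p∖q (false ∷ p) (true ∷ q) lt = there-∖ (∣q∣<∣p∣⇒∃x∈p∖q p q (<-trans (n<1+n _) lt))

∣p∪q∣≡∣p∣+∣q∣ : (p q : Subset n) → (∀ {x} → x ∈ₛ p → x ∉ₛ q) → ∣ p ∪ q ∣ ≡ ∣ p ∣ + ∣ q ∣
∣p∪q∣≡∣p∣+∣q∣ [] [] _ = refl
∣p∪q∣≡∣p∣+∣q∣ (a ∷ p) (b ∷ q) disj with ∣p∪q∣≡∣p∣+∣q∣ p q (λ x∈p x∈q → disj (there x∈p) (there x∈q))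
∣p∪q∣≡∣p∣+∣q∣ (true ∷ p) (true ∷ q) disj | _ = ⊥-elim (disj here here)
∣p∪q∣≡∣p∣+∣q∣ (true ∷ p) (false ∷ q) _ | eq = cong suc eq
∣p∪q∣≡∣p∣+∣q∣ (false ∷ p) (true ∷ q) _ | eq = trans (cong suc eq) (sym (+-suc ∣ p ∣ ∣ q ∣))
∣p∪q∣≡∣p∣+∣q∣ (false ∷ p) (false ∷ q) _ | eq = eq

meet : ∀ {x} {A B : Subset n} → x ∈ₛ A → x ∈ₛ B → Nonempty (A ∩ B)
meet x∈A x∈B = _ , x∈p∩q⁺ (x∈A , x∈B)

∣S∣<∣p∣+∣q∣⇒Nonempty∩ : ∀ {S p q : Subset n} → p ⊆ S → q ⊆ S → ∣ S ∣ < ∣ p ∣ + ∣ q ∣ → Nonempty (p ∩ q)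
∣S∣<∣p∣+∣q∣⇒Nonempty∩ {S = S} {p} {q} p⊆S q⊆S ∣S∣<∣p∣+∣q∣ with nonempty? (p ∩ q)
... | yes nonempty = nonempty
... | no empty = ⊥-elim (<⇒≱ ∣S∣<∣p∣+∣q∣ (begin
  ∣ p ∣ + ∣ q ∣ ≡⟨ ∣p∪q∣≡∣p∣+∣q∣ p q (λ x∈p x∈q → empty (meet x∈p x∈q)) ⟨
  ∣ p ∪ q ∣     ≤⟨ p⊆q⇒∣p∣≤∣q∣ (∪-least p⊆S q⊆S) ⟩
  ∣ S ∣         ∎))
  where
  open ≤-Reasoning
  ∪-least : p ⊆ S → q ⊆ S → p ∪ q ⊆ S
  ∪-least p⊆S q⊆S x∈ with x∈p∪q⁻ p q x∈
  ... | inj₁ x∈p = p⊆S x∈p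
  ... | inj₂ x∈q = q⊆S x∈q

Uniform : ℕ → List (Subset n) → Set
Uniform r F = ∀ {A} → A ∈ F → ∣ A ∣ ≡ r

Within : Subset n → List (Subset n) → Set
Within U F = ∀ {A} → A ∈ F → A ⊆ U

Intersecting : List (Subset n) → Set
Intersecting F = ∀ {A B} → A ∈ F → B ∈ F → Nonempty (A ∩ B)

unique-∷ : ∀ {x : X} {xs} → x ∉ xs → Unique xs → Unique (x ∷ xs)
unique-∷ {xs = xs} x∉xs u = ¬Any⇒All¬ xs x∉xs ∷ u

map⁺-injectiveOn : ∀ {Y : Set} (f : X → Y) {xs : List X} →
  (∀ {x y} → x ∈ xs → y ∈ xs → f x ≡ f y → x ≡ y) → Unique xs → Unique (map f xs)
map⁺-injectiveOn _ {[]} _ [] = []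
map⁺-injectiveOn f {x ∷ xs} inj u∷@(_ ∷ u) =
  unique-∷ fx∉ (map⁺-injectiveOn f (λ p q → inj (there p) (there q)) u)
  where
  fx∉ : f x ∉ map f xs
  fx∉ p with ∈-map⁻ f p
  ... | y , y∈ , fx≡fy with inj (here refl) (there y∈) fx≡fy
  ...   | refl = Unique[x∷xs]⇒x∉xs u∷ y∈

tailsOut tailsIn : List (Subset (suc n)) → List (Subset n)
tailsOut [] = []
tailsOut ((false ∷ A) ∷ F) = A ∷ tailsOut F
tailsOut ((true ∷ A) ∷ F) = tailsOut F
tailsIn [] = []
tailsIn ((false ∷ A) ∷ F) = tailsIn F
tailsIn ((true ∷ A) ∷ F) = A ∷ tailsIn F

module _ {A : Subset n} where

  ∈-tailsOut⁻ : ∀ F → A ∈ tailsOut F → (false ∷ A) ∈ F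
  ∈-tailsOut⁻ ((false ∷ B) ∷ F) (here refl) = here refl
  ∈-tailsOut⁻ ((false ∷ B) ∷ F) (there p) = there (∈-tailsOut⁻ F p)
  ∈-tailsOut⁻ ((true ∷ B) ∷ F) p = there (∈-tailsOut⁻ F p)

  ∈-tailsIn⁻ : ∀ F → A ∈ tailsIn F → (true ∷ A) ∈ F
  ∈-tailsIn⁻ ((true ∷ B) ∷ F) (here refl) = here refl
  ∈-tailsIn⁻ ((true ∷ B) ∷ F) (there p) = there (∈-tailsIn⁻ F p)
  ∈-tailsIn⁻ ((false ∷ B) ∷ F) p = there (∈-tailsIn⁻ F p)

length-tails : (F : List (Subset (suc n))) → length F ≡ length (tailsOut F) + length (tailsIn F)
length-tails [] = refl
length-tails ((false ∷ A) ∷ F) = cong suc (length-tails F)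
length-tails ((true ∷ A) ∷ F) = trans (cong suc (length-tails F)) (sym (+-suc _ _))

tailsOut-unique : (F : List (Subset (suc n))) → Unique F → Unique (tailsOut F)
tailsOut-unique [] _ = []
tailsOut-unique ((false ∷ A) ∷ F) u@(_ ∷ uF) =
  unique-∷ (λ p → Unique[x∷xs]⇒x∉xs u (∈-tailsOut⁻ F p)) (tailsOut-unique F uF)
tailsOut-unique ((true ∷ A) ∷ F) (_ ∷ uF) = tailsOut-unique F uF

tailsIn-unique : (F : List (Subset (suc n))) → Unique F → Unique (tailsIn F)
tailsIn-unique [] _ = []
tailsIn-unique ((true ∷ A) ∷ F) u@(_ ∷ uF) =
  unique-∷ (λ p → Unique[x∷xs]⇒x∉xs u (∈-tailsIn⁻ F p)) (tailsIn-unique F uF)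
tailsIn-unique ((false ∷ A) ∷ F) (_ ∷ uF) = tailsIn-unique F uF

module _ {F : List (Subset (suc n))} where

  tailsOut-uniform : ∀ {r} → Uniform r F → Uniform r (tailsOut F)
  tailsOut-uniform unif p = unif (∈-tailsOut⁻ F p)

  tailsIn-uniform : ∀ {r} → Uniform (suc r) F → Uniform r (tailsIn F)
  tailsIn-uniform unif p = suc-injective (unif (∈-tailsIn⁻ F p))

  tailsOut-within : ∀ {u U} → Within (u ∷ U) F → Within U (tailsOut F)
  tailsOut-within within p = drop-∷-⊆ (within (∈-tailsOut⁻ F p))

  tailsIn-within : ∀ {u U} → Within (u ∷ U) F → Within U (tailsIn F)
  tailsIn-within within p = drop-∷-⊆ (within (∈-tailsIn⁻ F p))

  tailsOut-intersecting : Intersecting F → Intersecting (tailsOut F)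
  tailsOut-intersecting inter p q with inter (∈-tailsOut⁻ F p) (∈-tailsOut⁻ F q)
  ... | suc x , x∈ = x , drop-there x∈

  length-tailsIn≡0 : ∀ {U} → Within (false ∷ U) F → length (tailsIn F) ≡ 0
  length-tailsIn≡0 within with tailsIn F in eq
  ... | [] = refl
  ... | A ∷ _ with within (∈-tailsIn⁻ F (subst (A ∈_) (sym eq) (here refl))) here
  ...   | ()

  length-tailsIn-uniform0 : Uniform 0 F → length (tailsIn F) ≡ 0
  length-tailsIn-uniform0 unif with tailsIn F in eq
  ... | [] = refl
  ... | A ∷ _ with unif (∈-tailsIn⁻ F (subst (A ∈_) (sym eq) (here refl)))
  ...   | ()

length≤1-Subset0 : (F : List (Subset 0)) → Unique F → length F ≤ 1
length≤1-Subset0 [] _ = z≤n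
length≤1-Subset0 ([] ∷ []) _ = s≤s z≤n
length≤1-Subset0 ([] ∷ [] ∷ F) u = ⊥-elim (Unique[x∷xs]⇒x∉xs u (here refl))

uniform-family-bound : ∀ r (U : Subset n) (F : List (Subset n)) →
  Unique F → Uniform r F → Within U F → length F ≤ ∣ U ∣ C r
uniform-family-bound zero [] F u _ _ = length≤1-Subset0 F u
uniform-family-bound (suc r) [] [] _ _ _ = z≤n
uniform-family-bound (suc r) [] ([] ∷ F) _ unif _ with unif (here refl)
... | ()
uniform-family-bound {suc n} r (b ∷ U) F u unif within = begin
  length F                                       ≡⟨ length-tails F ⟩
  length (tailsOut F) + length (tailsIn F)        ≤⟨ +-monoˡ-≤ _ outBound ⟩
  ∣ U ∣ C r + length (tailsIn F)                  ≤⟨ withTailsIn b r unif within ⟩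
  ∣ b ∷ U ∣ C r                                   ∎
  where
  open ≤-Reasoning
  outBound : length (tailsOut F) ≤ ∣ U ∣ C r
  outBound = uniform-family-bound r U (tailsOut F) (tailsOut-unique F u)
    (tailsOut-uniform unif) (tailsOut-within within)
  withTailsIn : ∀ b r → Uniform r F → Within (b ∷ U) F → ∣ U ∣ C r + length (tailsIn F) ≤ ∣ b ∷ U ∣ C r
  withTailsIn false r _ within = ≤-reflexive (trans (cong (_ +_) (length-tailsIn≡0 within)) (+-identityʳ _))
  withTailsIn true zero unif _ = ≤-reflexive (cong (1 +_) (length-tailsIn-uniform0 unif))
  withTailsIn true (suc r) unif within = begin
    ∣ U ∣ C suc r + length (tailsIn F)  ≤⟨ +-monoʳ-≤ _ tailsInBound ⟩
    ∣ U ∣ C suc r + ∣ U ∣ C r           ≡⟨ +-comm (∣ U ∣ C suc r) _ ⟩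
    ∣ U ∣ C r + ∣ U ∣ C suc r           ≡⟨ nCk+nC[k+1]≡[n+1]C[k+1] ∣ U ∣ r ⟩
    suc ∣ U ∣ C suc r                  ∎
    where
    tailsInBound : length (tailsIn F) ≤ ∣ U ∣ C r
    tailsInBound = uniform-family-bound r U (tailsIn F) (tailsIn-unique F u) (tailsIn-uniform unif)
      (tailsIn-within within)

-- The Erdős–Ko–Rado theorem, by shifting

_∈ᶠ?_ : (A : Subset n) (F : List (Subset n)) → Dec (A ∈ F)
A ∈ᶠ? F = Any.any? (≡-dec _≟ᵇ_ A) F

-- For a set {0} ∪ A (so A is indexed from 1), the same set with the point 0 replaced by y.
shiftTo : Fin n → Subset n → Subset (suc n)
shiftTo y A = false ∷ (A ∪ ⁅ y ⁆)

y∈shiftTo : ∀ y (A : Subset n) → suc y ∈ₛ shiftTo y A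
y∈shiftTo y A = there (x∈p∪q⁺ (inj₂ (x∈⁅x⁆ y)))

∈shiftTo⁺ : ∀ {x} y (A : Subset n) → x ∈ₛ A → suc x ∈ₛ shiftTo y A
∈shiftTo⁺ y A x∈A = there (x∈p∪q⁺ (inj₁ x∈A))

∈shiftTo⁻ : ∀ {x} y (A : Subset n) → suc x ∈ₛ shiftTo y A → x ≡ y ⊎ x ∈ₛ A
∈shiftTo⁻ y A (there x∈) with x∈p∪q⁻ A ⁅ y ⁆ x∈
... | inj₁ x∈A = inj₂ x∈A
... | inj₂ x∈y = inj₁ (x∈⁅y⁆⇒x≡y y x∈y)

∈-shiftTo-avoiding : ∀ {x y} (A B : Subset n) → y ∉ₛ A → x ∈ₛ A → suc x ∈ₛ shiftTo y B → x ∈ₛ B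
∈-shiftTo-avoiding {y = y} A B y∉A x∈A x∈ with ∈shiftTo⁻ y B x∈
... | inj₁ refl = ⊥-elim (y∉A x∈A)
... | inj₂ x∈B = x∈B

𝟙[0∈_] : Subset (suc n) → ℕ
𝟙[0∈ true ∷ _ ] = 1
𝟙[0∈ false ∷ _ ] = 0

length-tailsIn-∷ : ∀ A (F : List (Subset (suc n))) → length (tailsIn (A ∷ F)) ≡ 𝟙[0∈ A ] + length (tailsIn F)
length-tailsIn-∷ (true ∷ _) F = refl
length-tailsIn-∷ (false ∷ _) F = refl

module _ (f : Subset (suc n) → Subset (suc n)) where

  length-tailsIn-map-≤ : ∀ F → (∀ {A} → A ∈ F → 𝟙[0∈ f A ] ≤ 𝟙[0∈ A ]) →
    length (tailsIn (map f F)) ≤ length (tailsIn F)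
  length-tailsIn-map-≤ [] _ = z≤n
  length-tailsIn-map-≤ (A ∷ F) f≤ = begin
    length (tailsIn (f A ∷ map f F))       ≡⟨ length-tailsIn-∷ (f A) (map f F) ⟩
    𝟙[0∈ f A ] + length (tailsIn (map f F)) ≤⟨ +-mono-≤ (f≤ (here refl))
                                                         (length-tailsIn-map-≤ F (f≤ ∘ there)) ⟩
    𝟙[0∈ A ] + length (tailsIn F)           ≡⟨ length-tailsIn-∷ A F ⟨
    length (tailsIn (A ∷ F))               ∎
    where open ≤-Reasoning

  length-tailsIn-map-< : ∀ F → (∀ {A} → A ∈ F → 𝟙[0∈ f A ] ≤ 𝟙[0∈ A ]) →
    ∀ {A} → A ∈ F → 𝟙[0∈ f A ] < 𝟙[0∈ A ] → length (tailsIn (map f F)) < length (tailsIn F)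
  length-tailsIn-map-< (B ∷ F) f≤ B∈ f< = begin-strict
    length (tailsIn (f B ∷ map f F))       ≡⟨ length-tailsIn-∷ (f B) (map f F) ⟩
    𝟙[0∈ f B ] + length (tailsIn (map f F)) <⟨ tail-step B∈ ⟩
    𝟙[0∈ B ] + length (tailsIn F)           ≡⟨ length-tailsIn-∷ B F ⟨
    length (tailsIn (B ∷ F))               ∎
    where
    open ≤-Reasoning
    tail-step : _ ∈ B ∷ F → 𝟙[0∈ f B ] + length (tailsIn (map f F)) < 𝟙[0∈ B ] + length (tailsIn F)
    tail-step (here refl) = +-mono-<-≤ f< (length-tailsIn-map-≤ F (f≤ ∘ there))
    tail-step (there A∈F) = +-mono-≤-< (f≤ (here refl)) (length-tailsIn-map-< F (f≤ ∘ there) A∈F f<)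

module Shift (F : List (Subset (suc n))) (y : Fin n) where

  Shiftable : Subset (suc n) → Set
  Shiftable A = head A ≡ true × y ∉ₛ tail A × shiftTo y (tail A) ∉ F

  shiftable? : ∀ A → Dec (Shiftable A)
  shiftable? A = (head A ≟ᵇ true) ×-dec ¬? (y ∈? tail A) ×-dec ¬? (shiftTo y (tail A) ∈ᶠ? F)

  shift : Subset (suc n) → Subset (suc n)
  shift A with shiftable? A
  ... | yes _ = shiftTo y (tail A)
  ... | no _ = A

  shift-size : ∀ A → ∣ shift A ∣ ≡ ∣ A ∣
  shift-size A with shiftable? A
  shift-size (true ∷ A) | yes (_ , y∉A , _) = ∣p∪⁅x⁆∣≡1+∣p∣ A y∉A
  ... | no _ = refl

  shift-within : ∀ {u U} A → y ∈ₛ U → A ⊆ u ∷ U → shift A ⊆ u ∷ U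
  shift-within A y∈U A⊆ with shiftable? A
  ... | no _ = A⊆
  shift-within (a ∷ A) y∈U A⊆ | yes _ = within
    where
    within : shiftTo y A ⊆ _ ∷ _
    within {suc x} x∈ with ∈shiftTo⁻ y A x∈
    ... | inj₁ refl = there y∈U
    ... | inj₂ x∈A = A⊆ (there x∈A)

  shift-injective : ∀ {A B} → A ∈ F → B ∈ F → shift A ≡ shift B → A ≡ B
  shift-injective {A} {B} A∈F B∈F eq with shiftable? A | shiftable? B
  shift-injective {true ∷ A} {true ∷ B} _ _ eq | yes (_ , y∉A , _) | yes (_ , y∉B , _) =
    cong (true ∷_) (∪⁅x⁆-injective y∉A y∉B (cong tail eq))
  ... | yes (_ , _ , ∉F) | no _ = ⊥-elim (∉F (subst (_∈ F) (sym eq) B∈F))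
  ... | no _ | yes (_ , _ , ∉F) = ⊥-elim (∉F (subst (_∈ F) eq A∈F))
  ... | no _ | no _ = eq

  -- The subtle case is a fixed B through 0: it stays only because shiftTo y B is
  -- already in F, and A meets shiftTo y B inside B.
  shift-meets-fixed : ∀ {A B} → Intersecting F → A ∈ F → B ∈ F →
    Shiftable A → ¬ Shiftable B → Nonempty (shiftTo y (tail A) ∩ B)
  shift-meets-fixed {true ∷ A} {b ∷ B} inter A∈F B∈F (_ , y∉A , _) fixed
    with inter A∈F B∈F
  ... | _ , x∈ with x∈p∩q⁻ (true ∷ A) (b ∷ B) x∈
  ... | there x∈A , there x∈B = meet {B = b ∷ B} (∈shiftTo⁺ y A x∈A) (there x∈B)
  ... | here , here with y ∈? B
  ...   | yes y∈B = meet {B = true ∷ B} (y∈shiftTo y A) (there y∈B)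
  ...   | no y∉B with shiftTo y B ∈ᶠ? F
  ...     | no ∉F = ⊥-elim (fixed (refl , y∉B , ∉F))
  ...     | yes ∈F with inter A∈F ∈F
  ...       | _ , z∈ with x∈p∩q⁻ (true ∷ A) (shiftTo y B) z∈
  ...         | there x∈A , x∈ =
    meet {B = true ∷ B} (∈shiftTo⁺ y A x∈A) (there (∈-shiftTo-avoiding A B y∉A x∈A x∈))

  shift-intersecting : Intersecting F → ∀ {A B} → A ∈ F → B ∈ F → Nonempty (shift A ∩ shift B)
  shift-intersecting inter {A} {B} A∈F B∈F with shiftable? A | shiftable? B
  shift-intersecting _ {_ ∷ A} {_ ∷ B} _ _ | yes _ | yes _ = meet (y∈shiftTo y A) (y∈shiftTo y B)
  ... | yes sA | no fB = shift-meets-fixed inter A∈F B∈F sA fB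
  ... | no fA | yes sB = swap (shift-meets-fixed inter B∈F A∈F sB fA)
    where swap : ∀ {P Q : Subset (suc n)} → Nonempty (P ∩ Q) → Nonempty (Q ∩ P)
          swap {P} {Q} (x , x∈) = x , subst (x ∈ₛ_) (∩-comm P Q) x∈
  ... | no _ | no _ = inter A∈F B∈F

  shift-𝟙 : ∀ A → 𝟙[0∈ shift A ] ≤ 𝟙[0∈ A ]
  shift-𝟙 A with shiftable? A
  ... | no _ = ≤-refl
  ... | yes _ = z≤n

  shiftable-𝟙 : ∀ {A} → Shiftable A → 𝟙[0∈ shift A ] < 𝟙[0∈ A ]
  shiftable-𝟙 {A} sh with shiftable? A
  shiftable-𝟙 {true ∷ A} _ | yes _ = s≤s z≤n
  ... | no ¬sh = ⊥-elim (¬sh sh)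

  shifted-unique : Unique F → Unique (map shift F)
  shifted-unique = map⁺-injectiveOn shift shift-injective

  shifted-uniform : ∀ {r} → Uniform r F → Uniform r (map shift F)
  shifted-uniform unif A∈ with ∈-map⁻ shift A∈
  ... | A , A∈F , refl = trans (shift-size A) (unif A∈F)

  shifted-within : ∀ {u U} → y ∈ₛ U → Within (u ∷ U) F → Within (u ∷ U) (map shift F)
  shifted-within y∈U within A∈ with ∈-map⁻ shift A∈
  ... | A , A∈F , refl = shift-within A y∈U (within A∈F)

  shifted-intersecting : Intersecting F → Intersecting (map shift F)
  shifted-intersecting inter A∈ B∈ with ∈-map⁻ shift A∈ | ∈-map⁻ shift B∈
  ... | A , A∈F , refl | B , B∈F , refl = shift-intersecting inter A∈F B∈F

  shifted-fewer-through-0 : ∀ {A} → A ∈ F → Shiftable A →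
    length (tailsIn (map shift F)) < length (tailsIn F)
  shifted-fewer-through-0 A∈F sh = length-tailsIn-map-< shift F (λ {A} _ → shift-𝟙 A) A∈F (shiftable-𝟙 sh)

Stable : Subset n → List (Subset (suc n)) → Set
Stable U F = ∀ {B y} → (true ∷ B) ∈ F → y ∈ₛ U → y ∉ₛ B → shiftTo y B ∈ F

stable-or-shiftable : ∀ (U : Subset n) F →
  Stable U F ⊎ ∃ λ y → y ∈ₛ U × ∃ λ A → A ∈ F × Shift.Shiftable F y A
stable-or-shiftable U F with any? (λ y → (y ∈? U) ×-dec Any.any? (Shift.shiftable? F y) F)
... | yes (y , y∈U , someShiftable) = inj₂ (y , y∈U , find someShiftable)
... | no noneShiftable = inj₁ stable
  where
  stable : Stable U F
  stable {B} {y} B∈F y∈U y∉B with shiftTo y B ∈ᶠ? F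
  ... | yes ∈F = ∈F
  ... | no ∉F = ⊥-elim (noneShiftable (y , y∈U , lose B∈F (refl , y∉B , ∉F)))

-- By counting there is a point y ∈ U outside A ∪ B; stability puts shiftTo y B in F,
-- and {0} ∪ A meets it inside B.
stable-tailsIn-intersecting : ∀ {U : Subset n} {F r} → Stable U F → Within (true ∷ U) F →
  Uniform (suc r) F → Intersecting F → 2 * r < ∣ U ∣ → Intersecting (tailsIn F)
stable-tailsIn-intersecting {U = U} {F} {r} stable within unif inter 2r<∣U∣ {A} {B} A∈ B∈
  with ∣q∣<∣p∣⇒∃x∈p∖q U (A ∪ B) ∣A∪B∣<∣U∣
  where
  ∣A∪B∣<∣U∣ : ∣ A ∪ B ∣ < ∣ U ∣
  ∣A∪B∣<∣U∣ = ≤-<-trans (∣p∪q∣≤∣p∣+∣q∣ A B)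
    (subst₂ (λ a b → a + b < ∣ U ∣) (sym (tailsIn-uniform unif A∈)) (sym (tailsIn-uniform unif B∈))
      (subst (_< ∣ U ∣) (cong (r +_) (+-identityʳ r)) 2r<∣U∣))
... | y , y∈U , y∉A∪B with inter (∈-tailsIn⁻ F A∈) (stable (∈-tailsIn⁻ F B∈) y∈U (y∉A∪B ∘ x∈p∪q⁺ ∘ inj₂))
... | _ , x∈ with x∈p∩q⁻ (true ∷ A) (shiftTo y B) x∈
... | there x∈A , x∈shift = meet x∈A (∈-shiftTo-avoiding A B (y∉A∪B ∘ x∈p∪q⁺ ∘ inj₁) x∈A x∈shift)

ErdősKoRado : ℕ → Set
ErdősKoRado n = ∀ s (U : Subset n) F → 2 * suc s ≤ ∣ U ∣ →
  Unique F → Uniform (suc s) F → Within U F → Intersecting F → length F ≤ pred ∣ U ∣ C s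

ekr-singletons : (F : List (Subset n)) → Unique F → Uniform 1 F → Intersecting F → length F ≤ 1
ekr-singletons [] _ _ _ = z≤n
ekr-singletons (A ∷ []) _ _ _ = s≤s z≤n
ekr-singletons (A ∷ B ∷ F) u unif inter with inter (here refl) (there (here refl))
... | x , x∈ with x∈p∩q⁻ A B x∈
... | x∈A , x∈B = ⊥-elim (Unique[x∷xs]⇒x∉xs u (here A≡B))
  where
  A≡B : A ≡ B
  A≡B = trans (∣p∣≡1⇒p≡⁅x⁆ (unif (here refl)) x∈A) (sym (∣p∣≡1⇒p≡⁅x⁆ (unif (there (here refl))) x∈B))

-- When the ground set {0} ∪ U has exactly 2r points, complementing in U the members
-- avoiding 0 and dropping 0 from the others injects F into the (r-1)-subsets of U.
ekr-tight : ∀ {s} (U : Subset n) F → suc ∣ U ∣ ≡ 2 * suc s →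
  Unique F → Uniform (suc s) F → Within (true ∷ U) F → Intersecting F → length F ≤ ∣ U ∣ C s
ekr-tight {n} {s} U F tight u unif within inter = begin
  length F                                      ≡⟨ length-tails F ⟩
  length (tailsOut F) + length (tailsIn F)       ≡⟨ cong (_+ _) (length-map (U ─_) (tailsOut F)) ⟨
  length complements + length (tailsIn F)        ≡⟨ length-++ complements ⟨
  length (complements ++ tailsIn F)             ≤⟨ uniform-family-bound s U _ unique uniform within′ ⟩
  ∣ U ∣ C s                                     ∎
  where
  open ≤-Reasoning
  complements : List (Subset n)
  complements = map (U ─_) (tailsOut F)
  ∣U∣≡s+[1+s] : ∣ U ∣ ≡ s + suc s
  ∣U∣≡s+[1+s] = trans (suc-injective tight) (cong (s +_) (+-identityʳ (suc s)))
  out⊆U : Within U (tailsOut F)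
  out⊆U = tailsOut-within within
  disjoint : ∀ {C} → ¬ (C ∈ complements × C ∈ tailsIn F)
  disjoint (C∈ , C∈in) with ∈-map⁻ (U ─_) C∈
  ... | B , B∈out , refl with inter (∈-tailsIn⁻ F C∈in) (∈-tailsOut⁻ F B∈out)
  ... | _ , x∈ with x∈p∩q⁻ (true ∷ (U ─ B)) (false ∷ B) x∈
  ... | there x∈U─B , there x∈B = x∈p─q⇒x∉q U B x∈U─B x∈B
  unique : Unique (complements ++ tailsIn F)
  unique = ++⁺ (map⁺-injectiveOn (U ─_) (λ p q → ─-injective U (out⊆U p) (out⊆U q)) (tailsOut-unique F u))
               (tailsIn-unique F u) disjoint
  uniform : Uniform s (complements ++ tailsIn F)
  uniform C∈ with ∈-++⁻ complements C∈
  ... | inj₂ C∈in = tailsIn-uniform unif C∈in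
  ... | inj₁ C∈ with ∈-map⁻ (U ─_) C∈
  ...   | B , B∈out , refl = +-cancelʳ-≡ (suc s) _ s (trans (∣p─q∣+∣q∣≡∣p∣′) ∣U∣≡s+[1+s])
    where
    ∣p─q∣+∣q∣≡∣p∣′ : ∣ U ─ B ∣ + suc s ≡ ∣ U ∣
    ∣p─q∣+∣q∣≡∣p∣′ = subst (λ k → ∣ U ─ B ∣ + k ≡ ∣ U ∣) (tailsOut-uniform unif B∈out)
      (∣p─q∣+∣q∣≡∣p∣ U B (out⊆U B∈out))
  within′ : Within U (complements ++ tailsIn F)
  within′ C∈ with ∈-++⁻ complements C∈
  ... | inj₂ C∈in = tailsIn-within within C∈in
  ... | inj₁ C∈ with ∈-map⁻ (U ─_) C∈
  ...   | B , _ , refl = p─q⊆p U B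

ekr-stable : ErdősKoRado n → ∀ {s} {U : Subset n} {F} → Stable U F → 2 * suc (suc s) ≤ ∣ U ∣ →
  Unique F → Uniform (suc (suc s)) F → Within (true ∷ U) F → Intersecting F → length F ≤ ∣ U ∣ C suc s
ekr-stable ekr {s} {U} {F} stable 2r≤∣U∣ u unif within inter = begin
  length F                                   ≡⟨ length-tails F ⟩
  length (tailsOut F) + length (tailsIn F)    ≤⟨ +-mono-≤ outBound inBound ⟩
  pred ∣ U ∣ C suc s + pred ∣ U ∣ C s          ≡⟨ +-comm (pred ∣ U ∣ C suc s) _ ⟩
  pred ∣ U ∣ C s + pred ∣ U ∣ C suc s          ≡⟨ pascal ∣ U ∣ (≤-trans (s≤s z≤n) 2r≤∣U∣) ⟩
  ∣ U ∣ C suc s                               ∎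
  where
  open ≤-Reasoning
  pascal : ∀ m → 1 ≤ m → pred m C s + pred m C suc s ≡ m C suc s
  pascal (suc m) _ = nCk+nC[k+1]≡[n+1]C[k+1] m s
  2r<∣U∣ : 2 * suc s < ∣ U ∣
  2r<∣U∣ = <-≤-trans (*-monoʳ-< 2 (n<1+n (suc s))) 2r≤∣U∣
  outBound : length (tailsOut F) ≤ pred ∣ U ∣ C suc s
  outBound = ekr (suc s) U (tailsOut F) 2r≤∣U∣ (tailsOut-unique F u) (tailsOut-uniform unif)
    (tailsOut-within within) (tailsOut-intersecting inter)
  inBound : length (tailsIn F) ≤ pred ∣ U ∣ C s
  inBound = ekr s U (tailsIn F) (<⇒≤ 2r<∣U∣) (tailsIn-unique F u) (tailsIn-uniform unif)
    (tailsIn-within within) (stable-tailsIn-intersecting stable within unif inter 2r<∣U∣)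

-- Shifting strictly lowers the number of members through 0, so it terminates in a stable family.
ekr-shifting : ErdősKoRado n → ∀ {s} {U : Subset n} → 2 * suc (suc s) ≤ ∣ U ∣ →
  ∀ F → Acc _<_ (length (tailsIn F)) →
  Unique F → Uniform (suc (suc s)) F → Within (true ∷ U) F → Intersecting F → length F ≤ ∣ U ∣ C suc s
ekr-shifting ekr {U = U} 2r≤∣U∣ F (acc rec) u unif within inter with stable-or-shiftable U F
... | inj₁ stable = ekr-stable ekr stable 2r≤∣U∣ u unif within inter
... | inj₂ (y , y∈U , A , A∈F , shiftable) =
  subst (_≤ _) (length-map shift F)
    (ekr-shifting ekr 2r≤∣U∣ (map shift F) (rec (shifted-fewer-through-0 A∈F shiftable))
      (shifted-unique u) (shifted-uniform unif) (shifted-within y∈U within) (shifted-intersecting inter))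
  where open Shift F y

ekr-step : ErdősKoRado n → ErdősKoRado (suc n)
ekr-step ekr s (false ∷ U) F 2r≤∣U∣ u unif within inter = begin
  length F                                  ≡⟨ length-tails F ⟩
  length (tailsOut F) + length (tailsIn F)   ≡⟨ cong (length (tailsOut F) +_) (length-tailsIn≡0 within) ⟩
  length (tailsOut F) + 0                    ≡⟨ +-identityʳ _ ⟩
  length (tailsOut F)                        ≤⟨ ekr s U (tailsOut F) 2r≤∣U∣ (tailsOut-unique F u)
                                                  (tailsOut-uniform unif) (tailsOut-within within)
                                                  (tailsOut-intersecting inter) ⟩
  pred ∣ U ∣ C s                             ∎
  where open ≤-Reasoning
ekr-step _ zero (true ∷ _) F _ u unif _ inter = ekr-singletons F u unif inter
ekr-step ekr (suc s) (true ∷ U) F 2r≤1+∣U∣ u unif within inter with m≤n⇒m<n∨m≡n 2r≤1+∣U∣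
... | inj₂ tight = ekr-tight U F (sym tight) u unif within inter
... | inj₁ (s≤s 2r≤∣U∣) = ekr-shifting ekr 2r≤∣U∣ F (<-wellFounded _) u unif within inter

erdős-ko-rado : ∀ n → ErdősKoRado n
erdős-ko-rado zero s [] F ()
erdős-ko-rado (suc n) = ekr-step (erdős-ko-rado n)

-- Binomial coefficients

-- (k+1) C(n,k+1) = (n-k) C(n,k), with the subtraction moved across.
[1+k]*nC[1+k]+k*nCk≡n*nCk : ∀ n k → suc k * (n C suc k) + k * (n C k) ≡ n * (n C k)
[1+k]*nC[1+k]+k*nCk≡n*nCk zero zero = refl
[1+k]*nC[1+k]+k*nCk≡n*nCk zero (suc k) = cong₂ _+_ (*-zeroʳ (suc (suc k))) (*-zeroʳ (suc k))
[1+k]*nC[1+k]+k*nCk≡n*nCk (suc n) zero = trans (+-identityʳ _) (trans (+-identityʳ _)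
  (trans (nC1≡n (suc n)) (sym (*-identityʳ (suc n)))))
[1+k]*nC[1+k]+k*nCk≡n*nCk (suc n) (suc k) = begin
  suc (suc k) * (suc n C suc (suc k)) + suc k * (suc n C suc k)
    ≡⟨ cong₂ (λ x y → suc (suc k) * x + suc k * y) (nCk+nC[k+1]≡[n+1]C[k+1] n (suc k))
                                                   (nCk+nC[k+1]≡[n+1]C[k+1] n k) ⟨
  suc (suc k) * (b + a) + suc k * (c + b)
    ≡⟨ regroup k a b c ⟩
  (suc (suc k) * a + suc k * b) + (suc k * b + k * c) + b + c
    ≡⟨ cong₂ (λ x y → x + y + b + c) ([1+k]*nC[1+k]+k*nCk≡n*nCk n (suc k)) ([1+k]*nC[1+k]+k*nCk≡n*nCk n k) ⟩
  n * b + n * c + b + c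
    ≡⟨ collect n b c ⟩
  suc n * (c + b)
    ≡⟨ cong (suc n *_) (nCk+nC[k+1]≡[n+1]C[k+1] n k) ⟩
  suc n * (suc n C suc k) ∎
  where
  open ≡-Reasoning
  a b c : ℕ
  a = n C suc (suc k)
  b = n C suc k
  c = n C k
  regroup : ∀ k a b c → suc (suc k) * (b + a) + suc k * (c + b)
                        ≡ (suc (suc k) * a + suc k * b) + (suc k * b + k * c) + b + c
  regroup = solve-∀
  collect : ∀ n b c → n * b + n * c + b + c ≡ suc n * (c + b)
  collect = solve-∀

nCk≤[1+n]Ck : ∀ n k → n C k ≤ suc n C k
nCk≤[1+n]Ck n zero = ≤-refl
nCk≤[1+n]Ck n (suc k) = ≤-trans (m≤n+m (n C suc k) (n C k)) (≤-reflexive (nCk+nC[k+1]≡[n+1]C[k+1] n k))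

C-monoˡ-≤ : ∀ {m n} k → m ≤ n → m C k ≤ n C k
C-monoˡ-≤ {m} k m≤n = go (≤⇒≤′ m≤n)
  where
  go : ∀ {n} → m ≤′ n → m C k ≤ n C k
  go ≤′-refl = ≤-refl
  go (≤′-step m≤′n) = ≤-trans (go m≤′n) (nCk≤[1+n]Ck _ k)

mCk+nCk≤[m+n]Ck : ∀ m n k → 1 ≤ k → m C k + n C k ≤ (m + n) C k
mCk+nCk≤[m+n]Ck zero n (suc k) _ = ≤-refl
mCk+nCk≤[m+n]Ck (suc m) n (suc k) 1≤k = begin
  suc m C suc k + n C suc k             ≡⟨ cong (_+ n C suc k) (nCk+nC[k+1]≡[n+1]C[k+1] m k) ⟨
  (m C k + m C suc k) + n C suc k       ≡⟨ +-assoc (m C k) _ _ ⟩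
  m C k + (m C suc k + n C suc k)       ≤⟨ +-mono-≤ (C-monoˡ-≤ k (m≤m+n m n))
                                                   (mCk+nCk≤[m+n]Ck m n (suc k) 1≤k) ⟩
  (m + n) C k + (m + n) C suc k         ≡⟨ nCk+nC[k+1]≡[n+1]C[k+1] (m + n) k ⟩
  (suc m + n) C suc k                   ∎
  where open ≤-Reasoning

mC[1+k]+nC[1+k]+m*nCk≤[m+n]C[1+k] : ∀ m n k → 1 ≤ k →
  m C suc k + n C suc k + m * (n C k) ≤ (m + n) C suc k
mC[1+k]+nC[1+k]+m*nCk≤[m+n]C[1+k] zero n k _ = ≤-reflexive (+-identityʳ _)
mC[1+k]+nC[1+k]+m*nCk≤[m+n]C[1+k] (suc m) n k 1≤k = begin
  suc m C suc k + n C suc k + suc m * (n C k)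
    ≡⟨ cong (λ x → x + n C suc k + suc m * (n C k)) (nCk+nC[k+1]≡[n+1]C[k+1] m k) ⟨
  (m C k + m C suc k) + n C suc k + (n C k + m * (n C k))
    ≡⟨ regroup (m C k) (m C suc k) (n C suc k) (n C k) (m * (n C k)) ⟩
  (m C k + n C k) + (m C suc k + n C suc k + m * (n C k))
    ≤⟨ +-mono-≤ (mCk+nCk≤[m+n]Ck m n k 1≤k) (mC[1+k]+nC[1+k]+m*nCk≤[m+n]C[1+k] m n k 1≤k) ⟩
  (m + n) C k + (m + n) C suc k
    ≡⟨ nCk+nC[k+1]≡[n+1]C[k+1] (m + n) k ⟩
  (suc m + n) C suc k                   ∎
  where
  open ≤-Reasoning
  regroup : ∀ a b c d e → (a + b) + c + (d + e) ≡ (a + d) + (b + c + e)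
  regroup = solve-∀

nC[1+k]≤nCk : ∀ n k → n ≤ k + suc k → n C suc k ≤ n C k
nC[1+k]≤nCk n k n≤2k+1 = *-cancelˡ-≤ (suc k) (+-cancelʳ-≤ (k * (n C k)) _ _ (begin
  suc k * (n C suc k) + k * (n C k)   ≡⟨ [1+k]*nC[1+k]+k*nCk≡n*nCk n k ⟩
  n * (n C k)                         ≤⟨ *-monoˡ-≤ (n C k) n≤2k+1 ⟩
  (k + suc k) * (n C k)               ≡⟨ split k (n C k) ⟩
  suc k * (n C k) + k * (n C k)       ∎))
  where
  open ≤-Reasoning
  split : ∀ k c → (k + suc k) * c ≡ suc k * c + k * c
  split = solve-∀

nC[2+k]≤nCk : ∀ n k → n ≤ suc k + suc k → n C suc (suc k) ≤ n C k
nC[2+k]≤nCk n k n≤2k+2 = *-cancelˡ-≤ (suc (suc k)) (≤-trans step₁ step₂)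
  where
  open ≤-Reasoning
  step₁ : suc (suc k) * (n C suc (suc k)) ≤ suc k * (n C suc k)
  step₁ = +-cancelʳ-≤ (suc k * (n C suc k)) _ _ (begin
    suc (suc k) * (n C suc (suc k)) + suc k * (n C suc k) ≡⟨ [1+k]*nC[1+k]+k*nCk≡n*nCk n (suc k) ⟩
    n * (n C suc k)                                      ≤⟨ *-monoˡ-≤ (n C suc k) n≤2k+2 ⟩
    (suc k + suc k) * (n C suc k)                        ≡⟨ *-distribʳ-+ (n C suc k) (suc k) (suc k) ⟩
    suc k * (n C suc k) + suc k * (n C suc k)            ∎)
  step₂ : suc k * (n C suc k) ≤ suc (suc k) * (n C k)
  step₂ = +-cancelʳ-≤ (k * (n C k)) _ _ (begin
    suc k * (n C suc k) + k * (n C k)   ≡⟨ [1+k]*nC[1+k]+k*nCk≡n*nCk n k ⟩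
    n * (n C k)                         ≤⟨ *-monoˡ-≤ (n C k) n≤2k+2 ⟩
    (suc k + suc k) * (n C k)           ≡⟨ split k (n C k) ⟩
    suc (suc k) * (n C k) + k * (n C k) ∎)
    where
    split : ∀ k c → (suc k + suc k) * c ≡ suc (suc k) * c + k * c
    split = solve-∀

-- The bound for one colour class

-- The largest size of an intersecting family of (s+1)-subsets of a w-set: the
-- Erdős–Ko–Rado bound C(w-1,s) once w ≥ 2(s+1), and otherwise all C(w,s+1) subsets.
ekrBound : ℕ → ℕ → ℕ
ekrBound s w with 2 * suc s ≤? w
... | yes _ = pred w C s
... | no _ = w C suc s

ekrBound-large : ∀ s w → 2 * suc s ≤ w → ekrBound s w ≡ pred w C s
ekrBound-large s w large with 2 * suc s ≤? w
... | yes _ = refl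
... | no small = ⊥-elim (small large)

ekrBound-small : ∀ s w → ¬ 2 * suc s ≤ w → ekrBound s w ≡ w C suc s
ekrBound-small s w small with 2 * suc s ≤? w
... | yes large = ⊥-elim (small large)
... | no _ = refl

¬2[1+s]≤w⇒w≤s+[1+s] : ∀ s {w} → ¬ 2 * suc s ≤ w → w ≤ s + suc s
¬2[1+s]≤w⇒w≤s+[1+s] s small =
  ≤-pred (≤-trans (≰⇒> small) (≤-reflexive (cong suc (cong (s +_) (*-identityˡ (suc s))))))

ekrBound-large+large : ∀ s {a b} → 1 ≤ s → 2 * suc s ≤ a → 2 * suc s ≤ b →
  ekrBound s a + ekrBound s b ≤ ekrBound s (a + b)
ekrBound-large+large s {suc a} {suc b} 1≤s large-a large-b = begin
  ekrBound s (suc a) + ekrBound s (suc b) ≡⟨ cong₂ _+_ (ekrBound-large s (suc a) large-a)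
                                                       (ekrBound-large s (suc b) large-b) ⟩
  a C s + b C s                         ≤⟨ mCk+nCk≤[m+n]Ck a b s 1≤s ⟩
  (a + b) C s                           ≤⟨ C-monoˡ-≤ s (+-monoʳ-≤ a (n≤1+n b)) ⟩
  (a + suc b) C s                       ≡⟨ ekrBound-large s (suc a + suc b)
                                             (≤-trans large-a (m≤m+n (suc a) (suc b))) ⟨
  ekrBound s (suc a + suc b)            ∎
  where open ≤-Reasoning

ekrBound-small+large : ∀ s {a b} → 1 ≤ s → ¬ 2 * suc s ≤ a → 2 * suc s ≤ b → 2 * suc s ≤ a + b →
  ekrBound s a + ekrBound s b ≤ ekrBound s (a + b)
ekrBound-small+large s {a} {suc b} 1≤s small-a large-b large-ab = begin
  ekrBound s a + ekrBound s (suc b) ≡⟨ cong₂ _+_ (ekrBound-small s a small-a)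
                                                 (ekrBound-large s (suc b) large-b) ⟩
  a C suc s + b C s                 ≤⟨ +-monoˡ-≤ (b C s) (nC[1+k]≤nCk a s (¬2[1+s]≤w⇒w≤s+[1+s] s small-a)) ⟩
  a C s + b C s                     ≤⟨ mCk+nCk≤[m+n]Ck a b s 1≤s ⟩
  (a + b) C s                       ≡⟨ cong (_C s) (cong pred (+-suc a b)) ⟨
  pred (a + suc b) C s              ≡⟨ ekrBound-large s (a + suc b) large-ab ⟨
  ekrBound s (a + suc b)            ∎
  where open ≤-Reasoning

-- Two small supports whose union is large: the bound jumps from C(w,s+1) to C(w-1,s),
-- and C(a,s+1) + C(b,s+1) is paid for by the cross terms of Vandermonde's identity.
ekrBound-small+small : ∀ s {a b} → 2 ≤ s → ¬ 2 * suc s ≤ a → ¬ 2 * suc s ≤ b → 2 * suc s ≤ a + b →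
  ekrBound s a + ekrBound s b ≤ ekrBound s (a + b)
ekrBound-small+small s {zero} {b} _ _ small-b large-ab = ⊥-elim (small-b large-ab)
ekrBound-small+small s {suc a} {zero} _ small-a _ large-ab =
  ⊥-elim (small-a (subst (2 * suc s ≤_) (+-identityʳ (suc a)) large-ab))
ekrBound-small+small (suc zero) {suc a} {suc b} (s≤s ()) _ _ _
ekrBound-small+small s@(suc (suc u)) {suc a} {suc b} _ small-a small-b large-ab = begin
  ekrBound s (suc a) + ekrBound s (suc b)
    ≡⟨ cong₂ _+_ (ekrBound-small s (suc a) small-a) (ekrBound-small s (suc b) small-b) ⟩
  suc a C suc s + suc b C suc s
    ≡⟨ cong (suc a C suc s +_) (nCk+nC[k+1]≡[n+1]C[k+1] b s) ⟨
  suc a C suc s + (b C s + b C suc s)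
    ≤⟨ +-mono-≤ (nC[1+k]≤nCk (suc a) s (¬2[1+s]≤w⇒w≤s+[1+s] s small-a))
                (+-monoʳ-≤ (b C s) (nC[2+k]≤nCk b (suc u) b≤2s)) ⟩
  suc a C s + (b C s + b C suc u)
    ≤⟨ +-monoʳ-≤ (suc a C s) (+-monoʳ-≤ (b C s) (m≤m+n (b C suc u) (a * (b C suc u)))) ⟩
  suc a C s + (b C s + suc a * (b C suc u))
    ≡⟨ +-assoc (suc a C s) (b C s) (suc a * (b C suc u)) ⟨
  suc a C s + b C s + suc a * (b C suc u)
    ≤⟨ mC[1+k]+nC[1+k]+m*nCk≤[m+n]C[1+k] (suc a) b (suc u) (s≤s z≤n) ⟩
  (suc a + b) C s
    ≡⟨ cong (_C s) (cong pred (+-suc (suc a) b)) ⟨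
  pred (suc a + suc b) C s
    ≡⟨ ekrBound-large s (suc a + suc b) large-ab ⟨
  ekrBound s (suc a + suc b) ∎
  where
  open ≤-Reasoning
  b≤2s : b ≤ s + s
  b≤2s = ≤-pred (≤-trans (¬2[1+s]≤w⇒w≤s+[1+s] s small-b) (≤-reflexive (+-suc s s)))

ekrBound-superadditive : ∀ s a b → 2 ≤ s → ekrBound s a + ekrBound s b ≤ ekrBound s (a + b)
ekrBound-superadditive s a b 2≤s = cases (2 * suc s ≤? a + b) (2 * suc s ≤? a) (2 * suc s ≤? b)
  where
  1≤s : 1 ≤ s
  1≤s = ≤-trans (s≤s z≤n) 2≤s
  cases : Dec (2 * suc s ≤ a + b) → Dec (2 * suc s ≤ a) → Dec (2 * suc s ≤ b) →
    ekrBound s a + ekrBound s b ≤ ekrBound s (a + b)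
  cases (no small-ab) _ _ = begin
    ekrBound s a + ekrBound s b ≡⟨ cong₂ _+_ (ekrBound-small s a (small-ab ∘ (λ h → ≤-trans h (m≤m+n a b))))
                                             (ekrBound-small s b (small-ab ∘ (λ h → ≤-trans h (m≤n+m b a)))) ⟩
    a C suc s + b C suc s       ≤⟨ mCk+nCk≤[m+n]Ck a b (suc s) (s≤s z≤n) ⟩
    (a + b) C suc s             ≡⟨ ekrBound-small s (a + b) small-ab ⟨
    ekrBound s (a + b)          ∎
    where open ≤-Reasoning
  cases (yes _) (yes large-a) (yes large-b) = ekrBound-large+large s 1≤s large-a large-b
  cases (yes large-ab) (no small-a) (yes large-b) = ekrBound-small+large s 1≤s small-a large-b large-ab
  cases (yes large-ab) (yes large-a) (no small-b) =
    subst₂ _≤_ (+-comm (ekrBound s b) (ekrBound s a)) (cong (ekrBound s) (+-comm b a))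
      (ekrBound-small+large s 1≤s small-b large-a (subst (2 * suc s ≤_) (+-comm a b) large-ab))
  cases (yes large-ab) (no small-a) (no small-b) = ekrBound-small+small s 2≤s small-a small-b large-ab

ekrBound-mono : ∀ s {a b} → 2 ≤ s → a ≤ b → ekrBound s a ≤ ekrBound s b
ekrBound-mono s {a} {b} 2≤s a≤b = begin
  ekrBound s a                       ≤⟨ m≤m+n (ekrBound s a) (ekrBound s (b ∸ a)) ⟩
  ekrBound s a + ekrBound s (b ∸ a)  ≤⟨ ekrBound-superadditive s a (b ∸ a) 2≤s ⟩
  ekrBound s (a + (b ∸ a))           ≡⟨ cong (ekrBound s) (m+[n∸m]≡n a≤b) ⟩
  ekrBound s b                       ∎
  where open ≤-Reasoning

ekrBound-sum : ∀ s {k} → 2 ≤ s → (w : Fin k → ℕ) → sum (λ i → ekrBound s (w i)) ≤ ekrBound s (sum w)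
ekrBound-sum s {zero} _ _ = ≤-reflexive (sym (ekrBound-small s 0 (λ ())))
ekrBound-sum s {suc k} 2≤s w = ≤-trans (+-monoʳ-≤ (ekrBound s (w zero)) (ekrBound-sum s 2≤s (w ∘ suc)))
  (ekrBound-superadditive s (w zero) (sum (w ∘ suc)) 2≤s)

sum-mono-≤ : ∀ {k} {f g : Fin k → ℕ} → (∀ i → f i ≤ g i) → sum f ≤ sum g
sum-mono-≤ {zero} _ = z≤n
sum-mono-≤ {suc k} f≤g = +-mono-≤ (f≤g zero) (sum-mono-≤ (f≤g ∘ suc))

sum≡∧≤⇒≗ : ∀ {k} {f g : Fin k → ℕ} → (∀ i → f i ≤ g i) → sum f ≡ sum g → f ≗ g
sum≡∧≤⇒≗ {suc k} {f} {g} f≤g eq i with m≤n⇒m<n∨m≡n (f≤g zero)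
... | inj₁ f0<g0 = ⊥-elim (<⇒≢ (+-mono-<-≤ f0<g0 (sum-mono-≤ (f≤g ∘ suc))) eq)
... | inj₂ f0≡g0 with i
...   | zero = f0≡g0
...   | suc j = sum≡∧≤⇒≗ (f≤g ∘ suc) (+-cancelˡ-≡ (f zero) _ _ (trans eq (cong (_+ _) (sym f0≡g0)))) j

ekrBound1≡pred : ∀ w → 4 ≤ w → ekrBound 1 w ≡ pred w
ekrBound1≡pred w 4≤w = trans (ekrBound-large 1 w 4≤w) (nC1≡n (pred w))

ekrBound1≤ : ∀ w → ekrBound 1 w ≤ w
ekrBound1≤ 0 = z≤n
ekrBound1≤ 1 = z≤n
ekrBound1≤ 2 = s≤s z≤n
ekrBound1≤ 3 = ≤-refl
ekrBound1≤ w@(suc (suc (suc (suc _)))) =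
  ≤-trans (≤-reflexive (ekrBound1≡pred w (s≤s (s≤s (s≤s (s≤s z≤n)))))) (n≤1+n (pred w))

ekrBound1≡⇒0∨3 : ∀ w → ekrBound 1 w ≡ w → w ≡ 0 ⊎ w ≡ 3
ekrBound1≡⇒0∨3 0 _ = inj₁ refl
ekrBound1≡⇒0∨3 1 ()
ekrBound1≡⇒0∨3 2 ()
ekrBound1≡⇒0∨3 3 _ = inj₂ refl
ekrBound1≡⇒0∨3 w@(suc (suc (suc (suc _)))) eq =
  ⊥-elim (<⇒≢ (n<1+n (pred w)) (trans (sym (ekrBound1≡pred w (s≤s (s≤s (s≤s (s≤s z≤n)))))) eq))

-- Colour classes of an independent set

⊆⋃ : ∀ {A} (F : List (Subset n)) → A ∈ F → A ⊆ ⋃ F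
⊆⋃ (A ∷ F) (here refl) = p⊆p∪q (⋃ F)
⊆⋃ (B ∷ F) (there A∈F) = q⊆p∪q B (⋃ F) ∘ ⊆⋃ F A∈F

∈⋃⁻ : ∀ {x} (F : List (Subset n)) → x ∈ₛ ⋃ F → ∃ λ A → A ∈ F × x ∈ₛ A
∈⋃⁻ [] x∈ = ⊥-elim (∉⊥ x∈)
∈⋃⁻ (A ∷ F) x∈ with x∈p∪q⁻ A (⋃ F) x∈
... | inj₁ x∈A = A , here refl , x∈A
... | inj₂ x∈⋃F with ∈⋃⁻ F x∈⋃F
...   | B , B∈F , x∈B = B , there B∈F , x∈B

-- R is the part of [n] already used up.
sum-∣∣-disjoint≤ : ∀ {k} (W : Fin k → Subset n) (R : Subset n) →
  (∀ {i j x} → x ∈ₛ W i → x ∈ₛ W j → i ≡ j) → (∀ {i x} → x ∈ₛ W i → x ∉ₛ R) →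
  sum (λ i → ∣ W i ∣) + ∣ R ∣ ≤ n
sum-∣∣-disjoint≤ {k = zero} W R _ _ = ∣p∣≤n R
sum-∣∣-disjoint≤ {n} {k = suc k} W R disjoint avoidsR = begin
  (∣ W zero ∣ + sum (λ i → ∣ W (suc i) ∣)) + ∣ R ∣ ≡⟨ cong (_+ ∣ R ∣) (+-comm ∣ W zero ∣ _) ⟩
  (sum (λ i → ∣ W (suc i) ∣) + ∣ W zero ∣) + ∣ R ∣ ≡⟨ +-assoc (sum (λ i → ∣ W (suc i) ∣)) _ _ ⟩
  sum (λ i → ∣ W (suc i) ∣) + (∣ W zero ∣ + ∣ R ∣) ≡⟨ cong (sum (λ i → ∣ W (suc i) ∣) +_)
                                                          (∣p∪q∣≡∣p∣+∣q∣ (W zero) R avoidsR) ⟨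
  sum (λ i → ∣ W (suc i) ∣) + ∣ W zero ∪ R ∣        ≤⟨ sum-∣∣-disjoint≤ (W ∘ suc) (W zero ∪ R)
                                                       (Finₚ.suc-injective ∘₂ disjoint) avoids ⟩
  n                                               ∎
  where
  open ≤-Reasoning
  avoids : ∀ {i x} → x ∈ₛ W (suc i) → x ∉ₛ W zero ∪ R
  avoids x∈ x∈∪ with x∈p∪q⁻ (W zero) R x∈∪
  ... | inj₁ x∈W₀ with disjoint x∈ x∈W₀
  ...   | ()
  avoids x∈ _ | inj₂ x∈R = avoidsR x∈ x∈R

colourClass : Fin k → List (Vertex k n) → List (Subset n)
colourClass i [] = []
colourClass i ((j , X) ∷ H) with i ≟ᶠ j
... | yes _ = X ∷ colourClass i H
... | no _ = colourClass i H

colourSupport : Fin k → List (Vertex k n) → Subset n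
colourSupport i H = ⋃ (colourClass i H)

∈-colourClass⁻ : ∀ (i : Fin k) (H : List (Vertex k n)) {X} → X ∈ colourClass i H → (i , X) ∈ H
∈-colourClass⁻ i ((j , Y) ∷ H) X∈ with i ≟ᶠ j
∈-colourClass⁻ i ((j , Y) ∷ H) (here refl) | yes refl = here refl
∈-colourClass⁻ i ((j , Y) ∷ H) (there X∈) | yes refl = there (∈-colourClass⁻ i H X∈)
... | no _ = there (∈-colourClass⁻ i H X∈)

colourClass-unique : ∀ (i : Fin k) (H : List (Vertex k n)) → Unique H → Unique (colourClass i H)
colourClass-unique i [] _ = []
colourClass-unique i ((j , X) ∷ H) u@(_ ∷ uH) with i ≟ᶠ j
... | yes refl = unique-∷ (Unique[x∷xs]⇒x∉xs u ∘ ∈-colourClass⁻ i H) (colourClass-unique i H uH)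
... | no _ = colourClass-unique i H uH

δ : Fin k → Fin k → ℕ
δ j i = if does (i ≟ᶠ j) then 1 else 0

sum-δ : ∀ (j : Fin k) → sum (δ j) ≡ 1
sum-δ {suc k} zero = cong suc (sum-replicate-zero k)
sum-δ {suc k} (suc j) = sum-δ j

length-colourClass-∷ : ∀ (i : Fin k) j X (H : List (Vertex k n)) →
  length (colourClass i ((j , X) ∷ H)) ≡ δ j i + length (colourClass i H)
length-colourClass-∷ i j X H with i ≟ᶠ j
... | yes _ = refl
... | no _ = refl

length≡sum-colourClass : (H : List (Vertex k n)) → length H ≡ sum (λ i → length (colourClass i H))
length≡sum-colourClass {k} [] = sym (sum-replicate-zero k)
length≡sum-colourClass ((j , X) ∷ H) = begin
  suc (length H)
    ≡⟨ cong₂ _+_ (sum-δ j) (sym (length≡sum-colourClass H)) ⟨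
  sum (δ j) + sum (λ i → length (colourClass i H))
    ≡⟨ ∑-distrib-+ (δ j) _ ⟨
  sum (λ i → δ j i + length (colourClass i H))
    ≡⟨ sum-cong-≗ (λ i → length-colourClass-∷ i j X H) ⟨
  sum (λ i → length (colourClass i ((j , X) ∷ H))) ∎
  where open ≡-Reasoning

Nonempty∩⇒¬Disj : ∀ {X Y : Subset n} → Nonempty (X ∩ Y) → ¬ Disj X Y
Nonempty∩⇒¬Disj (x , x∈X∩Y) X∩Y≡⊥ = ∉⊥ (subst (x ∈ₛ_) X∩Y≡⊥ x∈X∩Y)

¬Disj⇒Nonempty∩ : ∀ (X Y : Subset n) → ¬ Disj X Y → Nonempty (X ∩ Y)
¬Disj⇒Nonempty∩ X Y ¬disj with nonempty? (X ∩ Y)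
... | yes nonempty = nonempty
... | no empty = ⊥-elim (¬disj (Empty-unique empty))

∣p∣≡1+s⇒Nonempty : ∀ {n s} (p : Subset n) → ∣ p ∣ ≡ suc s → Nonempty p
∣p∣≡1+s⇒Nonempty {n} p ∣p∣≡1+s with nonempty? p
... | yes nonempty = nonempty
... | no empty with trans (sym ∣p∣≡1+s) (trans (cong ∣_∣ (Empty-unique empty)) (∣⊥∣≡0 n))
...   | ()

module IndependentSet {s} {H : List (Vertex k n)} (indep : IsIndependent (suc s) H) where

  private
    unique : Unique H
    unique = proj₁ indep
    vertex : ∀ {u} → u ∈ H → IsVertex (suc s) u
    vertex = proj₁ (proj₂ indep)
    nonadjacent : ∀ {u v} → u ∈ H → v ∈ H → ¬ u ≡ v → ¬ Adj u v
    nonadjacent = proj₂ (proj₂ indep)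

  colourClass-uniform : ∀ i → Uniform (suc s) (colourClass i H)
  colourClass-uniform i = vertex ∘ ∈-colourClass⁻ i H

  colourClass-intersecting : ∀ i → Intersecting (colourClass i H)
  colourClass-intersecting i {X} {Y} X∈ Y∈ with ≡-dec _≟ᵇ_ X Y
  ... | yes refl with ∣p∣≡1+s⇒Nonempty X (colourClass-uniform i X∈)
  ...   | _ , x∈X = meet x∈X x∈X
  colourClass-intersecting i {X} {Y} X∈ Y∈ | no X≢Y =
    ¬Disj⇒Nonempty∩ X Y λ disj → nonadjacent (∈-colourClass⁻ i H X∈) (∈-colourClass⁻ i H Y∈)
      (X≢Y ∘ cong proj₂) (inj₁ (refl , disj))

  colourSupports-disjoint : ∀ {i j x} → x ∈ₛ colourSupport i H → x ∈ₛ colourSupport j H → i ≡ j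
  colourSupports-disjoint {i} {j} x∈Wi x∈Wj with i ≟ᶠ j
  ... | yes i≡j = i≡j
  ... | no i≢j with ∈⋃⁻ (colourClass i H) x∈Wi | ∈⋃⁻ (colourClass j H) x∈Wj
  ...   | X , X∈ , x∈X | Y , Y∈ , x∈Y = ⊥-elim (nonadjacent (∈-colourClass⁻ i H X∈) (∈-colourClass⁻ j H Y∈)
          (i≢j ∘ cong proj₁) (inj₂ (i≢j , Nonempty∩⇒¬Disj (meet x∈X x∈Y))))

  colourClass-bound : ∀ i → length (colourClass i H) ≤ ekrBound s ∣ colourSupport i H ∣
  colourClass-bound i = bound (2 * suc s ≤? ∣ W ∣)
    where
    W : Subset n
    W = colourSupport i H
    F : List (Subset n)
    F = colourClass i H
    bound : Dec (2 * suc s ≤ ∣ W ∣) → length F ≤ ekrBound s ∣ W ∣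
    bound (yes large) = ≤-trans
      (erdős-ko-rado n s W F large (colourClass-unique i H unique) (colourClass-uniform i) (⊆⋃ F)
        (colourClass-intersecting i))
      (≤-reflexive (sym (ekrBound-large s ∣ W ∣ large)))
    bound (no small) = ≤-trans
      (uniform-family-bound (suc s) W F (colourClass-unique i H unique) (colourClass-uniform i) (⊆⋃ F))
      (≤-reflexive (sym (ekrBound-small s ∣ W ∣ small)))

  length≤sum-ekrBound : length H ≤ sum (λ i → ekrBound s ∣ colourSupport i H ∣)
  length≤sum-ekrBound = ≤-trans (≤-reflexive (length≡sum-colourClass H)) (sum-mono-≤ colourClass-bound)

  sum-colourSupport≤n : sum (λ i → ∣ colourSupport i H ∣) ≤ n
  sum-colourSupport≤n = ≤-trans (m≤m+n _ ∣ ⊥ {n} ∣)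
    (sum-∣∣-disjoint≤ (λ i → colourSupport i H) ⊥ colourSupports-disjoint (λ _ → ∉⊥))

-- Extremal independent sets

Solution : ℕ → ℕ → ℕ → Set
Solution r k n = Σ (List (Vertex k n)) λ H → Σ (Fin k → Subset n) λ S →
  IsMaxIndependent r H
  × IsPartition S
  × (∀ (i : Fin k) (X : Subset n) → (i , X) ∈ H → X ⊆ S i)
  × (ExactlyOneNonempty S ⊎ (∀ (i : Fin k) → ∣ S i ∣ ≡ 0 ⊎ ∣ S i ∣ ≡ 2 * r ∸ 1))

subsetsOfSize : (n s : ℕ) → List (Subset n)
subsetsOfSize n zero = ⊥ ∷ []
subsetsOfSize zero (suc s) = []
subsetsOfSize (suc n) (suc s) = map (true ∷_) (subsetsOfSize n s) ++ map (false ∷_) (subsetsOfSize n (suc s))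

length-subsetsOfSize : (n s : ℕ) → length (subsetsOfSize n s) ≡ n C s
length-subsetsOfSize n zero = refl
length-subsetsOfSize zero (suc s) = refl
length-subsetsOfSize (suc n) (suc s) = begin
  length (map (true ∷_) (subsetsOfSize n s) ++ map (false ∷_) (subsetsOfSize n (suc s)))
    ≡⟨ length-++ (map (true ∷_) (subsetsOfSize n s)) ⟩
  length (map (true ∷_) (subsetsOfSize n s)) + length (map (false ∷_) (subsetsOfSize n (suc s)))
    ≡⟨ cong₂ _+_ (length-map (true ∷_) (subsetsOfSize n s))
                 (length-map (false ∷_) (subsetsOfSize n (suc s))) ⟩
  length (subsetsOfSize n s) + length (subsetsOfSize n (suc s))
    ≡⟨ cong₂ _+_ (length-subsetsOfSize n s) (length-subsetsOfSize n (suc s)) ⟩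
  n C s + n C suc s
    ≡⟨ nCk+nC[k+1]≡[n+1]C[k+1] n s ⟩
  suc n C suc s ∎
  where open ≡-Reasoning

subsetsOfSize-unique : (n s : ℕ) → Unique (subsetsOfSize n s)
subsetsOfSize-unique n zero = [] ∷ []
subsetsOfSize-unique zero (suc s) = []
subsetsOfSize-unique (suc n) (suc s) =
  ++⁺ (map⁺ ∷-injectiveʳ (subsetsOfSize-unique n s)) (map⁺ ∷-injectiveʳ (subsetsOfSize-unique n (suc s)))
    λ (p , q) → heads-differ (∈-map⁻ (true ∷_) p) (∈-map⁻ (false ∷_) q)
  where
  heads-differ : ∀ {X : Subset (suc n)} → (∃ λ A → A ∈ subsetsOfSize n s × X ≡ true ∷ A) →
    ¬ (∃ λ B → B ∈ subsetsOfSize n (suc s) × X ≡ false ∷ B)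
  heads-differ (_ , _ , refl) (_ , _ , ())

subsetsOfSize-uniform : (n s : ℕ) → Uniform s (subsetsOfSize n s)
subsetsOfSize-uniform n zero (here refl) = ∣⊥∣≡0 n
subsetsOfSize-uniform (suc n) (suc s) X∈ with ∈-++⁻ (map (true ∷_) (subsetsOfSize n s)) X∈
... | inj₁ X∈₁ with ∈-map⁻ (true ∷_) X∈₁
...   | A , A∈ , refl = cong suc (subsetsOfSize-uniform n s A∈)
subsetsOfSize-uniform (suc n) (suc s) X∈ | inj₂ X∈₂ with ∈-map⁻ (false ∷_) X∈₂
...   | A , A∈ , refl = subsetsOfSize-uniform n (suc s) A∈

-- Vertices of different colours lie in disjoint blocks, so they are disjoint and hence
-- non-adjacent; only the colour classes need to be intersecting.
independent-in-blocks : ∀ {r} (S : Fin k → Subset n) (H : List (Vertex k n)) →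
  Unique H → (∀ {u} → u ∈ H → IsVertex r u) → (∀ {i X} → (i , X) ∈ H → X ⊆ S i) →
  (∀ i j → ¬ i ≡ j → Disj (S i) (S j)) → (∀ {i X Y} → (i , X) ∈ H → (i , Y) ∈ H → Nonempty (X ∩ Y)) →
  IsIndependent r H
independent-in-blocks S H unique vertex inBlock blocksDisjoint classIntersecting =
  unique , vertex , nonadjacent
  where
  nonadjacent : ∀ {u v} → u ∈ H → v ∈ H → ¬ u ≡ v → ¬ Adj u v
  nonadjacent u∈ v∈ _ (inj₁ (refl , disj)) = Nonempty∩⇒¬Disj (classIntersecting u∈ v∈) disj
  nonadjacent {i , X} {j , Y} u∈ v∈ _ (inj₂ (i≢j , ¬disj)) = ¬disj (Empty-unique empty)
    where
    empty : ¬ Nonempty (X ∩ Y)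
    empty (x , x∈X∩Y) with x∈p∩q⁻ X Y x∈X∩Y
    ... | x∈X , x∈Y = ∉⊥ (subst (x ∈ₛ_) (blocksDisjoint i j i≢j) (x∈p∩q⁺ (inBlock u∈ x∈X , inBlock v∈ x∈Y)))

star : ∀ k n s → List (Vertex (suc k) (suc n))
star k n s = map (λ B → zero , true ∷ B) (subsetsOfSize n s)

starBlocks : ∀ {k n} → Fin (suc k) → Subset n
starBlocks zero = ⊤
starBlocks (suc _) = ⊥

star-solution : ∀ k n s → (∀ H → IsIndependent (suc s) H → length H ≤ n C s) →
  Solution (suc s) (suc k) (suc n)
star-solution k n s maximal =
  star k n s , starBlocks ,
  (independent , λ H′ indep′ → ≤-trans (maximal H′ indep′) (≤-reflexive (sym length-star))) ,
  (blocksDisjoint , λ x → zero , ∈⊤) ,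
  (λ i X X∈ → inBlock X∈) ,
  inj₁ (zero , (zero , ∈⊤) , onlyZero)
  where
  members : ∀ {u} → u ∈ star k n s → ∃ λ B → B ∈ subsetsOfSize n s × u ≡ (zero , true ∷ B)
  members = ∈-map⁻ (λ B → zero , true ∷ B)
  length-star : length (star k n s) ≡ n C s
  length-star = trans (length-map _ (subsetsOfSize n s)) (length-subsetsOfSize n s)
  inBlock : ∀ {i X} → (i , X) ∈ star k n s → X ⊆ starBlocks i
  inBlock X∈ with members X∈
  ... | _ , _ , refl = λ _ → ∈⊤
  blocksDisjoint : ∀ i j → ¬ i ≡ j → Disj (starBlocks {n = suc n} i) (starBlocks j)
  blocksDisjoint zero zero i≢j = ⊥-elim (i≢j refl)
  blocksDisjoint zero (suc _) _ = ∩-zeroʳ ⊤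
  blocksDisjoint (suc _) j _ = ∩-zeroˡ (starBlocks j)
  onlyZero : ∀ j → ¬ j ≡ zero → ¬ Nonempty (starBlocks {n = suc n} j)
  onlyZero zero j≢0 = ⊥-elim (j≢0 refl)
  onlyZero (suc _) _ (_ , x∈⊥) = ∉⊥ x∈⊥
  independent : IsIndependent (suc s) (star k n s)
  independent = independent-in-blocks starBlocks (star k n s)
    (map⁺ (∷-injectiveʳ ∘ cong proj₂) (subsetsOfSize-unique n s))
    (λ u∈ → vertex (members u∈)) inBlock blocksDisjoint
    (λ X∈ Y∈ → throughZero (members X∈) (members Y∈))
    where
    vertex : ∀ {u} → (∃ λ B → B ∈ subsetsOfSize n s × u ≡ (zero , true ∷ B)) → IsVertex (suc s) u
    vertex (B , B∈ , refl) = cong suc (subsetsOfSize-uniform n s B∈)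
    throughZero : ∀ {i X Y} → (∃ λ B → B ∈ subsetsOfSize n s × (i , X) ≡ (zero , true ∷ B)) →
      (∃ λ B → B ∈ subsetsOfSize n s × (i , Y) ≡ (zero , true ∷ B)) → Nonempty (X ∩ Y)
    throughZero (_ , _ , refl) (_ , _ , refl) = zero , here

pad3 : Subset n → Subset (3 + n)
pad3 X = false ∷ false ∷ false ∷ X

pairsOf012 : List (Subset (3 + n))
pairsOf012 = (true ∷ true ∷ false ∷ ⊥) ∷ (true ∷ false ∷ true ∷ ⊥) ∷ (false ∷ true ∷ true ∷ ⊥) ∷ []

-- Block j = {3j, 3j+1, 3j+2} gets colour col j, and every 2-subset of a block is a
-- vertex of its colour.
triangles : ∀ m → (Fin m → Fin k) → List (Vertex k (m * 3))
triangles zero col = []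
triangles (suc m) col = map (col zero ,_) pairsOf012 ++ map (λ (i , X) → i , pad3 X) (triangles m (col ∘ suc))

triangleBlocks : ∀ m → (Fin m → Fin k) → Fin k → Subset (m * 3)
triangleBlocks zero col i = []
triangleBlocks (suc m) col i = b ∷ b ∷ b ∷ triangleBlocks m (col ∘ suc) i
  where
  b : Bool
  b = does (col zero ≟ᶠ i)

length-triangles : ∀ m (col : Fin m → Fin k) → length (triangles m col) ≡ m * 3
length-triangles zero col = refl
length-triangles (suc m) col =
  cong (3 +_) (trans (length-map _ (triangles m (col ∘ suc))) (length-triangles m (col ∘ suc)))

data TriangleMember {m} (col : Fin (suc m) → Fin k) : Vertex k (suc m * 3) → Set where
  fresh : ∀ {X} → X ∈ pairsOf012 → TriangleMember col (col zero , X)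
  padded : ∀ {i X} → (i , X) ∈ triangles m (col ∘ suc) → TriangleMember col (i , pad3 X)

triangleMember : ∀ {m} (col : Fin (suc m) → Fin k) {u} → u ∈ triangles (suc m) col → TriangleMember col u
triangleMember {m = m} col u∈ with ∈-++⁻ (map (col zero ,_) pairsOf012) u∈
... | inj₁ u∈fresh with ∈-map⁻ (col zero ,_) u∈fresh
...   | X , X∈ , refl = fresh X∈
triangleMember {m = m} col u∈ | inj₂ u∈padded with ∈-map⁻ (λ (i , X) → i , pad3 X) u∈padded
...   | (i , X) , v∈ , refl = padded v∈

triangles-unique : ∀ m (col : Fin m → Fin k) → Unique (triangles m col)
triangles-unique zero col = []
triangles-unique (suc m) col = ++⁺ freshUnique
  (map⁺ pad3-injective (triangles-unique m (col ∘ suc)))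
  λ (u∈fresh , u∈padded) → fresh∉padded (∈-map⁻ _ u∈fresh) (∈-map⁻ _ u∈padded)
  where
  freshUnique : Unique (map (col zero ,_) (pairsOf012 {m * 3}))
  freshUnique = ((λ ()) ∷ (λ ()) ∷ []) ∷ ((λ ()) ∷ []) ∷ [] ∷ []
  pad3-injective : ∀ {u v : Vertex k (m * 3)} →
    (proj₁ u , pad3 (proj₂ u)) ≡ (proj₁ v , pad3 (proj₂ v)) → u ≡ v
  pad3-injective refl = refl
  fresh∉padded : ∀ {u} → (∃ λ X → X ∈ pairsOf012 × u ≡ (col zero , X)) →
    ¬ (∃ λ v → v ∈ triangles m (col ∘ suc) × u ≡ (proj₁ v , pad3 (proj₂ v)))
  fresh∉padded (_ , here refl , refl) (_ , _ , ())
  fresh∉padded (_ , there (here refl) , refl) (_ , _ , ())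
  fresh∉padded (_ , there (there (here refl)) , refl) (_ , _ , ())

triangles-vertex : ∀ m (col : Fin m → Fin k) {u} → u ∈ triangles m col → IsVertex 2 u
triangles-vertex (suc m) col u∈ with triangleMember col u∈
... | fresh (here refl) = cong (2 +_) (∣⊥∣≡0 (m * 3))
... | fresh (there (here refl)) = cong (2 +_) (∣⊥∣≡0 (m * 3))
... | fresh (there (there (here refl))) = cong (2 +_) (∣⊥∣≡0 (m * 3))
... | padded v∈ = triangles-vertex m (col ∘ suc) v∈

pairsOf012⊆012 : ∀ {P} → P ∈ pairsOf012 {n} → P ⊆ true ∷ true ∷ true ∷ ⊥
pairsOf012⊆012 P∈ {zero} _ = here
pairsOf012⊆012 P∈ {suc zero} _ = there here
pairsOf012⊆012 P∈ {suc (suc zero)} _ = there (there here)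
pairsOf012⊆012 (here refl) (there (there (there x∈⊥))) = ⊥-elim (∉⊥ x∈⊥)
pairsOf012⊆012 (there (here refl)) (there (there (there x∈⊥))) = ⊥-elim (∉⊥ x∈⊥)
pairsOf012⊆012 (there (there (here refl))) (there (there (there x∈⊥))) = ⊥-elim (∉⊥ x∈⊥)

012⊆ownBlock : ∀ m (col : Fin (suc m) → Fin k) →
  true ∷ true ∷ true ∷ ⊥ ⊆ triangleBlocks (suc m) col (col zero)
012⊆ownBlock m col x∈ with col zero ≟ᶠ col zero
... | no c≢c = ⊥-elim (c≢c refl)
012⊆ownBlock m col here | yes _ = here
012⊆ownBlock m col (there here) | yes _ = there here
012⊆ownBlock m col (there (there here)) | yes _ = there (there here)
012⊆ownBlock m col (there (there (there x∈⊥))) | yes _ = ⊥-elim (∉⊥ x∈⊥)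

triangles-inBlock : ∀ m (col : Fin m → Fin k) {i X} → (i , X) ∈ triangles m col → X ⊆ triangleBlocks m col i
triangles-inBlock (suc m) col X∈ with triangleMember col X∈
... | fresh P∈ = 012⊆ownBlock m col ∘ pairsOf012⊆012 P∈
... | padded v∈ = paddedIn (triangles-inBlock m (col ∘ suc) v∈)
  where
  paddedIn : ∀ {i X} → X ⊆ triangleBlocks m (col ∘ suc) i → pad3 X ⊆ triangleBlocks (suc m) col i
  paddedIn X⊆ (there (there (there x∈))) = there (there (there (X⊆ x∈)))

triangleBlocks-disjoint : ∀ m (col : Fin m → Fin k) {i j x} →
  x ∈ₛ triangleBlocks m col i → x ∈ₛ triangleBlocks m col j → i ≡ j
triangleBlocks-disjoint (suc m) col {i} {j} x∈i x∈j with col zero ≟ᶠ i | col zero ≟ᶠ j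
... | yes refl | yes refl = refl
triangleBlocks-disjoint (suc m) col (there (there (there x∈i))) (there (there (there x∈j))) | no _ | _ =
  triangleBlocks-disjoint m (col ∘ suc) x∈i x∈j
triangleBlocks-disjoint (suc m) col (there (there (there x∈i))) (there (there (there x∈j))) | yes _ | no _ =
  triangleBlocks-disjoint m (col ∘ suc) x∈i x∈j

triangleBlocks-cover : ∀ m (col : Fin m → Fin k) x → ∃ λ i → x ∈ₛ triangleBlocks m col i
triangleBlocks-cover (suc m) col zero = col zero , 012⊆ownBlock m col here
triangleBlocks-cover (suc m) col (suc zero) = col zero , 012⊆ownBlock m col (there here)
triangleBlocks-cover (suc m) col (suc (suc zero)) = col zero , 012⊆ownBlock m col (there (there here))
triangleBlocks-cover (suc m) col (suc (suc (suc x))) with triangleBlocks-cover m (col ∘ suc) x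
... | i , x∈ = i , there (there (there x∈))

triangleBlocks-unused : ∀ m (col : Fin m → Fin k) i → (∀ j → ¬ col j ≡ i) → ∣ triangleBlocks m col i ∣ ≡ 0
triangleBlocks-unused zero col i _ = refl
triangleBlocks-unused (suc m) col i unused with col zero ≟ᶠ i
... | yes c≡i = ⊥-elim (unused zero c≡i)
... | no _ = triangleBlocks-unused m (col ∘ suc) i (unused ∘ suc)

triangleBlocks-size : ∀ m (col : Fin m → Fin k) → (∀ {a b} → col a ≡ col b → a ≡ b) →
  ∀ i → ∣ triangleBlocks m col i ∣ ≡ 0 ⊎ ∣ triangleBlocks m col i ∣ ≡ 3
triangleBlocks-size zero col _ i = inj₁ refl
triangleBlocks-size (suc m) col injective i with col zero ≟ᶠ i
... | yes refl = inj₂ (cong (3 +_) (triangleBlocks-unused m (col ∘ suc) (col zero)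
                     λ j c≡c → Finₚ.0≢1+n (injective (sym c≡c))))
... | no _ = triangleBlocks-size m (col ∘ suc) (Finₚ.suc-injective ∘ injective) i

triangle-solution : ∀ k m → m ≤ k → (∀ H → IsIndependent 2 H → length H ≤ m * 3) → Solution 2 k (m * 3)
triangle-solution k m m≤k maximal =
  triangles m col , triangleBlocks m col ,
  (independent , λ H′ indep′ → ≤-trans (maximal H′ indep′) (≤-reflexive (sym (length-triangles m col)))) ,
  (blocksDisjoint , triangleBlocks-cover m col) ,
  (λ i X → triangles-inBlock m col) ,
  inj₂ (triangleBlocks-size m col injective)
  where
  col : Fin m → Fin k
  col j = inject≤ j m≤k
  injective : ∀ {a b} → col a ≡ col b → a ≡ b
  injective = Finₚ.inject≤-injective m≤k m≤k _ _
  blocksDisjoint : ∀ i j → ¬ i ≡ j → Disj (triangleBlocks m col i) (triangleBlocks m col j)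
  blocksDisjoint i j i≢j = Empty-unique λ (x , x∈) →
    let x∈i , x∈j = x∈p∩q⁻ (triangleBlocks m col i) _ x∈ in i≢j (triangleBlocks-disjoint m col x∈i x∈j)
  ∣block∣≤3 : ∀ i → ∣ triangleBlocks m col i ∣ ≤ 3
  ∣block∣≤3 i with triangleBlocks-size m col injective i
  ... | inj₁ ∣block∣≡0 = ≤-trans (≤-reflexive ∣block∣≡0) z≤n
  ... | inj₂ ∣block∣≡3 = ≤-reflexive ∣block∣≡3
  independent : IsIndependent 2 (triangles m col)
  independent = independent-in-blocks (triangleBlocks m col) (triangles m col) (triangles-unique m col)
    (triangles-vertex m col) (triangles-inBlock m col) blocksDisjoint
    λ {i} X∈ Y∈ → ∣S∣<∣p∣+∣q∣⇒Nonempty∩ (triangles-inBlock m col X∈) (triangles-inBlock m col Y∈)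
      (≤-trans (s≤s (∣block∣≤3 i))
        (≤-reflexive (sym (cong₂ _+_ (triangles-vertex m col X∈) (triangles-vertex m col Y∈)))))

independence-number≤ : ∀ {s} {H : List (Vertex k n)} → 2 ≤ s → 2 * suc s ≤ n → IsIndependent (suc s) H →
  length H ≤ pred n C s
independence-number≤ {n = n} {s} {H} 2≤s 2r≤n indep = begin
  length H                                             ≤⟨ length≤sum-ekrBound ⟩
  sum (λ i → ekrBound s ∣ colourSupport i H ∣)          ≤⟨ ekrBound-sum s 2≤s (λ i → ∣ colourSupport i H ∣) ⟩
  ekrBound s (sum (λ i → ∣ colourSupport i H ∣))        ≤⟨ ekrBound-mono s 2≤s sum-colourSupport≤n ⟩
  ekrBound s n                                         ≡⟨ ekrBound-large s n 2r≤n ⟩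
  pred n C s                                           ∎
  where
  open ≤-Reasoning
  open IndependentSet indep

sum-0or3 : ∀ {k} (w : Fin k → ℕ) → (∀ i → w i ≡ 0 ⊎ w i ≡ 3) → ∃ λ m → sum w ≡ m * 3 × m ≤ k
sum-0or3 {zero} w _ = 0 , refl , z≤n
sum-0or3 {suc k} w w0or3 with sum-0or3 (w ∘ suc) (w0or3 ∘ suc) | w0or3 zero
... | m , sum≡m*3 , m≤k | inj₁ w₀≡0 = m , cong₂ _+_ w₀≡0 sum≡m*3 , m≤n⇒m≤1+n m≤k
... | m , sum≡m*3 , m≤k | inj₂ w₀≡3 = suc m , cong₂ _+_ w₀≡3 sum≡m*3 , s≤s m≤k

module _ {H : List (Vertex k n)} (indep : IsIndependent 2 H) where

  open IndependentSet indep

  private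
    w : Fin k → ℕ
    w i = ∣ colourSupport i H ∣

    classes≤supports : ∀ i → ekrBound 1 (w i) ≤ w i
    classes≤supports i = ekrBound1≤ (w i)

  independence-number₂≤ : length H ≤ n
  independence-number₂≤ = ≤-trans length≤sum-ekrBound (≤-trans (sum-mono-≤ classes≤supports) sum-colourSupport≤n)

  independence-number₂≡n : length H ≡ n → ∃ λ m → n ≡ m * 3 × m ≤ k
  independence-number₂≡n length≡n = rescale (sum-0or3 w supports0or3)
    where
    n≤∑bound : n ≤ sum (λ i → ekrBound 1 (w i))
    n≤∑bound = subst (_≤ sum (λ i → ekrBound 1 (w i))) length≡n length≤sum-ekrBound
    ∑w≡n : sum w ≡ n
    ∑w≡n = ≤-antisym sum-colourSupport≤n (≤-trans n≤∑bound (sum-mono-≤ classes≤supports))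
    supports0or3 : ∀ i → w i ≡ 0 ⊎ w i ≡ 3
    supports0or3 i = ekrBound1≡⇒0∨3 (w i) (sum≡∧≤⇒≗ classes≤supports
      (≤-antisym (sum-mono-≤ classes≤supports) (≤-trans (≤-reflexive ∑w≡n) n≤∑bound)) i)
    rescale : (∃ λ m → sum w ≡ m * 3 × m ≤ k) → ∃ λ m → n ≡ m * 3 × m ≤ k
    rescale (m , ∑w≡m*3 , m≤k) = m , trans (sym ∑w≡n) ∑w≡m*3 , m≤k

triangle-decomposable? : ∀ n k → Dec (∃ λ m → n ≡ m * 3 × m ≤ k)
triangle-decomposable? n k with 3 ∣? n
... | no 3∤n = no λ (m , n≡m*3 , _) → 3∤n (divides m n≡m*3)
... | yes (divides q n≡q*3) with q ≤? k
...   | yes q≤k = yes (q , n≡q*3 , q≤k)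
...   | no q≰k = no λ (m , n≡m*3 , m≤k) → q≰k (subst (_≤ k) (*-cancelʳ-≡ m q 3 (trans (sym n≡m*3) n≡q*3)) m≤k)

solution-r≥3 : ∀ s k n → 2 ≤ s → 2 * suc s ≤ suc n → Solution (suc s) (suc k) (suc n)
solution-r≥3 s k n 2≤s 2r≤n = star-solution k n s λ H → independence-number≤ 2≤s 2r≤n

solution-r=2 : ∀ k n → 4 ≤ n → Solution 2 (suc k) n
solution-r=2 k n 4≤n with triangle-decomposable? n (suc k)
... | yes (m , refl , m≤k) = triangle-solution (suc k) m m≤k λ H → independence-number₂≤
solution-r=2 k (suc n) _ | no ¬decomposable = star-solution k n 1 λ H indep →
  subst (length H ≤_) (sym (nC1≡n n))
    (≤-pred (≤∧≢⇒< (independence-number₂≤ indep) (¬decomposable ∘ independence-number₂≡n indep)))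

corollary4p24 : (r k n : ℕ) → 2 ≤ r → 1 ≤ k → 2 * r ≤ n →
    Σ (List (Vertex k n)) λ H → Σ (Fin k → Subset n) λ S →
    IsMaxIndependent r H
    × IsPartition S
    × (∀ (i : Fin k) (X : Subset n) → (i , X) ∈ H → X ⊆ S i)
    × (ExactlyOneNonempty S ⊎ (∀ (i : Fin k) → ∣ S i ∣ ≡ 0 ⊎ ∣ S i ∣ ≡ 2 * r ∸ 1))
corollary4p24 1 _ _ (s≤s ()) _ _
corollary4p24 2 (suc k) n _ _ 4≤n = solution-r=2 k n 4≤n
corollary4p24 (suc s@(suc (suc _))) (suc k) (suc n) _ _ 2r≤n = solution-r≥3 s k n (s≤s (s≤s z≤n)) 2r≤n
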